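{- Let $p$ be an odd prime, $\gamma\vdash n-2p$ a self-conjugate $p$-core, $\mathfrak{B}_\gamma$ the set of partitions of $n$ with $p$-core $\gamma$, and for $1\le k\le\frac{p-1}{2}$ let $\nu_k=\left\langle\frac{p-1}{2}-k,\frac{p-1}{2}+k\right\rangle$ and $\mu_k=\left\lceil\frac{p-1}{2}-k,\frac{p-1}{2}+k\right\rfloor$. Then for $1\le k\le\frac{p-1}{2}$: if $k\le\delta$ then $\mu_k\in\partial_{2k}$ and $\nu_k\in\partial_{2k-1}$; if $k>\delta$ then $\mu_k\in\partial_{2k-1}$ and $\nu_k\in\partial_{2k}$.
   Context: Abacus: for a partition $\lambda$, place beads at positions $\lambda_i-i$ ($i\ge1$) on the $p$-abacus (runners indexed by residues mod $p$; moving a bead down one position means $x\mapsto x+p$). For the $p$-core $\gamma$, let $\rho_0<\dots<\rho_{p-1}$ be the positions of the lowest bead on each runner; the runner containing $\rho_r$ is runner $r$. Labels: for $0\le a<b\le p-1$, $\langle a,b\rangle$ is obtained from the abacus of $\gamma$ by moving the beads at $\rho_a$ and $\rho_b$ each down one position; $\langle a\rangle$ by moving the bead at $\rho_a$ to $\rho_a+2p$; $\langle a^2\rangle$ by moving the bead at $\rho_a$ to $\rho_a+p$ and the bead at $\rho_a-p$ to $\rho_a$. Pyramid: for $0\le a\le b\le p-1$, ${}^a\gamma_b=1$ if $\rho_b-\rho_a<p$ and $0$ if $\rho_b-\rho_a>p$; extended by ${}^a\gamma_b=1$ if $a>b$ and ${}^a\gamma_b=0$ if $a<0$ or $b\ge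 p$. For $0\le a\le b<p$, $a<p-1$: $\lceil a,b\rfloor=\langle a+1\rangle$ if $a=b$ and ${}^{a+1}\gamma_{a+2}=0$; $\langle a+1,a+2\rangle$ if $a=b$ and ${}^{a+1}\gamma_{a+2}=1$; $\langle a+1,b\rangle$ if $a\ne b$ and ${}^{a+1}\gamma_b=0$; $\langle b^2\rangle$ if $a\ne b$, ${}^{a+1}\gamma_b=1$, ${}^a\gamma_b=0$; $\langle a\rangle$ if $a\ne b$, ${}^a\gamma_b=1$, ${}^a\gamma_{b+1}=0$; $\langle a,b+1\rangle$ if $a\ne b$ and ${}^a\gamma_{b+1}=1$. $\delta$: for $1\le k\le\frac{p-1}{2}$ put $g_k={}^{\frac{p-1}{2}-k}\gamma_{\frac{p-1}{2}+k}$; $\delta=0$ if $g_k=0$ for all $k$, otherwise $\delta=\max\{k\mid g_k=1\}$. For $\lambda\in\mathfrak{B}_\gamma$, $\partial\lambda$ is the absolute value of the difference of the leg lengths of two $p$-rim-hooks removed successively from $\lambda$ to reach $\gamma$ (independent of choices), and $\partial_l=\{\lambda\in\mathfrak{B}_\gamma\mid\partial\lambda=l\}$. -}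

module Defs where

open import Data.Nat as ℕ using (ℕ; zero; suc; _∸_; _≤?_; ∣_-_∣) renaming (_+_ to _+ℕ_; _*_ to _*ℕ_)
open import Data.Nat.DivMod using (_/_)
open import Data.Integer as ℤ using (ℤ; +_; _+_; _-_; -_)
import Data.Integer.Properties as ℤP
open import Data.Bool using (Bool; true; false; if_then_else_; _∨_; not)
open import Data.List using (List; []; _∷_; length; map; filter; applyUpTo)
open import Data.Bool.ListAction using (any)
open import Data.Nat.ListAction using (sum)
open import Data.List.Relation.Unary.All using (All)
open import Data.List.Relation.Unary.Linked using (Linked)
open import Data.Product using (Σ; _×_)
open import Relation.Nullary using (¬_; does)
open import Relation.Binary.PropositionalEquality using (_≡_)

IsPartition : List ℕ → Set
IsPartition λ′ = All (ℕ._<_ 0) λ′ × Linked ℕ._≥_ λ′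

nth : List ℕ → ℕ → ℕ
nth []       _       = 0
nth (x ∷ xs) zero    = x
nth (x ∷ xs) (suc i) = nth xs i

-- λ_i, one-indexed (λ_i = 0 for i > length λ)
part : List ℕ → ℕ → ℕ
part λ′ i = nth λ′ (i ∸ 1)

size : List ℕ → ℕ
size = sum

conj : List ℕ → List ℕ
conj λ′ = map (λ j → length (filter (j ≤?_) λ′)) (applyUpTo suc (part λ′ 1))

-- Abacus: the bead set { λ_i - i | i ≥ 1 } ⊆ ℤ, as a Boolean predicate.
-- For i > length λ the bead is -i, i.e. all positions < -(length λ).

_=ᶻ_ : ℤ → ℤ → Bool
x =ᶻ y = does (x ℤP.≟ y)

_<ᶻ_ : ℤ → ℤ → Bool
x <ᶻ y = does (x ℤP.<? y)

bead : List ℕ → ℤ → Bool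
bead λ′ x = (x <ᶻ (- (+ length λ′)))
          ∨ any (λ i → x =ᶻ ((+ part λ′ i) - (+ i))) (applyUpTo suc (length λ′))

mv : (ℤ → Bool) → ℤ → ℤ → ℤ → Bool
mv S from to x = if x =ᶻ to then true else if x =ᶻ from then false else S x

legCount : (ℤ → Bool) → ℕ → ℤ → ℕ
legCount S p x = sum (map (λ j → if S (x - (+ j)) then 1 else 0) (applyUpTo suc (p ∸ 1)))

-- RemoveHook p λ μ l : μ is obtained from λ by removing a p-rim-hook of
-- leg length l (abacus description: a bead slides from x to the empty
-- position x - p; the leg length is the number of beads strictly between).
RemoveHook : ℕ → List ℕ → List ℕ → ℕ → Set
RemoveHook p λ′ μ l =
  IsPartition μ ×
  Σ ℤ (λ x → bead λ′ x ≡ true × bead λ′ (x - (+ p)) ≡ false ×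
             (∀ y → bead μ y ≡ mv (bead λ′) x (x - (+ p)) y) ×
             l ≡ legCount (bead λ′) p x)

IsCore : ℕ → List ℕ → Set
IsCore p γ = ∀ μ l → ¬ RemoveHook p γ μ l

-- λ ∈ ∂_l (relative to γ): λ reaches γ by removing two p-rim-hooks
-- successively, and for every such pair of removals the absolute
-- difference of the leg lengths is l.
InPartial : ℕ → List ℕ → ℕ → List ℕ → Set
InPartial p γ l λ′ =
  Σ (List ℕ) (λ μ → Σ ℕ (λ l₁ → Σ ℕ (λ l₂ → RemoveHook p λ′ μ l₁ × RemoveHook p μ γ l₂)))
  × (∀ μ l₁ l₂ → RemoveHook p λ′ μ l₁ → RemoveHook p μ γ l₂ → ∣ l₁ - l₂ ∣ ≡ l)

-- ρ : the positions ρ_0 < … < ρ_{p-1} of the lowest beads on the p runners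
IsRho : ℕ → List ℕ → (ℕ → ℤ) → Set
IsRho p γ ρ =
  (∀ r → r ℕ.< p → bead γ (ρ r) ≡ true × (∀ m → bead γ (ρ r + (+ (suc m *ℕ p))) ≡ false))
  × (∀ r s → r ℕ.< s → s ℕ.< p → ρ r ℤ.< ρ s)

data Label : Set where
  pair : ℕ → ℕ → Label
  sing : ℕ → Label
  sq   : ℕ → Label

module Labels (p : ℕ) (ρ : ℕ → ℤ) where

  P : ℤ
  P = + p

  pyr : ℕ → ℕ → Bool
  pyr a b = if does (suc b ≤? a) then true
            else if does (p ≤? b) then false
            else ((ρ b - ρ a) <ᶻ P)

  labelBeads : (ℤ → Bool) → Label → ℤ → Bool
  labelBeads S (pair a b) = mv (mv S (ρ a) (ρ a + P)) (ρ b) (ρ b + P)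
  labelBeads S (sing a)   = mv S (ρ a) (ρ a + P + P)
  labelBeads S (sq a)     = mv (mv S (ρ a) (ρ a + P)) (ρ a - P) (ρ a)

  ceil : ℕ → ℕ → Label
  ceil a b =
    if does (a ℕ.≟ b)
    then (if pyr (suc a) (suc (suc a)) then pair (suc a) (suc (suc a)) else sing (suc a))
    else (if not (pyr (suc a) b) then pair (suc a) b
          else if not (pyr a b) then sq b
          else if not (pyr a (suc b)) then sing a
          else pair a (suc b))

  h : ℕ
  h = (p ∸ 1) / 2

  g : ℕ → Bool
  g k = pyr (h ∸ k) (h +ℕ k)

  δaux : ℕ → ℕ
  δaux zero    = 0
  δaux (suc m) = if g (suc m) then suc m else δaux m

  δ : ℕ
  δ = δaux h

LabelIn : ℕ → (ℕ → ℤ) → List ℕ → ℕ → Label → ℕ → Set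
LabelIn p ρ γ n L l =
  Σ (List ℕ) (λ λ′ → IsPartition λ′ × size λ′ ≡ n ×
     (∀ x → bead λ′ x ≡ Labels.labelBeads p ρ (bead γ) L x) × InPartial p γ l λ′)

{-# OPTIONS --safe #-}
module Submission where

-- On the p-abacus a partition in 𝔅_γ arises from γ by twice moving a bead one step down its
-- runner, and the leg length of the p-hook whose bead sits at x is the number of beads strictly
-- between x - p and x. For a p-core every runner meets a window (w - p, w] in one position, which
-- holds a bead exactly when it is not below the runner's lowest bead ρ_c; so the window holds
-- #{c | w - p < ρ_c} beads, and each leg length is read off from where w - p falls among the ρ_c.
-- The bead set of a label determines its removal orders (two for ⟨a,b⟩, one for ⟨b²⟩ and ⟨a⟩),
-- and in each of them the legs differ by b - a or b - a - 1 according to one pyramid entry. For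
-- ν_k = ⟨a,b⟩ with a = (p-1)/2 - k, b = (p-1)/2 + k that entry is g_k, and the case split defining
-- μ_k = ⌈a,b⌋ puts μ_k on the other side. Finally g_k = 1 exactly when k ≤ δ, because an entry
-- ^aγ_b can only drop from 1 to 0 as the interval [a,b] widens.

open import Defs

import Data.Integer.Properties as ℤP
import Data.Nat.Properties as ℕP
import Data.Nat.Tactic.RingSolver as NS
open import Data.Bool using (Bool; true; false; if_then_else_; _∨_)
open import Data.Bool.Properties using (∨-identityʳ; ∨-conicalˡ; ∨-conicalʳ; ¬-not)
open import Data.Empty using (⊥-elim)
open import Data.Unit using (⊤; tt)
open import Data.Integer using (ℤ)
import Data.Fin as Fin
import Data.Fin.Properties as FinP
open import Data.Fin using (Fin; toℕ; fromℕ<)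
open import Data.Nat.DivMod using (m≡m%n+[m/n]*n; m*n/n≡m)
open import Data.Integer.DivMod using (a≡a%ℕn+[a/ℕn]*n; n%ℕd<d)
open import Data.Integer.Tactic.RingSolver using (solve-∀)
open import Data.List using (List; []; _∷_; length; map; applyUpTo; _∷ʳ_; _++_)
import Data.List.Properties as LP
import Data.Nat.ListAction.Properties as NLP
open import Data.List.Relation.Unary.All using ([]; _∷_)
open import Data.List.Relation.Unary.Linked using ([]; [-]; _∷_)
open import Data.Bool.ListAction using (any)
open import Data.Nat as ℕ using (ℕ; zero; suc; z≤n; s≤s; _∸_; ∣_-_∣)
open import Data.Nat.Primality using (Prime)
open import Data.Nat.ListAction using (sum)
open import Data.Product using (Σ; _×_; _,_; proj₁; proj₂; uncurry)
open import Data.Sum using (_⊎_; inj₁; inj₂)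
open import Relation.Binary.PropositionalEquality
open import Relation.Binary using (tri<; tri≈; tri>)
open import Relation.Nullary using (yes; no)
open import Relation.Nullary.Decidable using (dec-true; dec-false)
open import Algebra.Properties.CommutativeSemigroup ℕP.+-commutativeSemigroup using (x∙yz≈y∙xz) renaming (interchange to +-interchange)
open import Algebra.Properties.AbelianGroup ℤP.+-0-abelianGroup using (∙-cancelʳ)
open import Function using (_∘_)

true≢false : true ≢ false
true≢false ()

∨-true-⊎ : ∀ a b → a ∨ b ≡ true → a ≡ true ⊎ b ≡ true
∨-true-⊎ true  _ _ = inj₁ refl
∨-true-⊎ false _ e = inj₂ e

bit : Bool → ℕ
bit b = if b then 1 else 0

count : (ℕ → Bool) → ℕ → ℕ
count f zero    = 0
count f (suc n) = bit (f n) ℕ.+ count f n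

count-cong : ∀ n (f g : ℕ → Bool) → (∀ c → c ℕ.< n → f c ≡ g c) → count f n ≡ count g n
count-cong zero    _ _ _   = refl
count-cong (suc n) f g f≡g = cong₂ ℕ._+_ (cong bit (f≡g n ℕP.≤-refl)) (count-cong n f g (λ c c<n → f≡g c (ℕP.m<n⇒m<1+n c<n)))

count-none : ∀ n (f : ℕ → Bool) → (∀ c → c ℕ.< n → f c ≡ false) → count f n ≡ 0
count-none zero    _ _  = refl
count-none (suc n) f ¬f rewrite ¬f n ℕP.≤-refl = count-none n f (λ c c<n → ¬f c (ℕP.m<n⇒m<1+n c<n))

count-one : ∀ n (f : ℕ → Bool) {c₀} → c₀ ℕ.< n → f c₀ ≡ true → (∀ c → c ℕ.< n → f c ≡ true → c ≡ c₀) →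
            count f n ≡ 1
count-one (suc n) f {c₀} c₀<1+n fc₀ unique with ℕP.m<1+n⇒m<n∨m≡n c₀<1+n
... | inj₂ refl rewrite fc₀ = cong suc (count-none n f λ c c<n → ¬-not λ fc → ℕP.<⇒≢ c<n (unique c (ℕP.m<n⇒m<1+n c<n) fc))
... | inj₁ c₀<n rewrite ¬-not {f n} (λ fn → ℕP.<⇒≢ c₀<n (sym (unique n ℕP.≤-refl fn))) =
  count-one n f c₀<n fc₀ (λ c c<n → unique c (ℕP.m<n⇒m<1+n c<n))

count-upper : ∀ n m (f : ℕ → Bool) → (∀ c → c ℕ.< n → c ℕ.< m → f c ≡ false) →
              (∀ c → c ℕ.< n → m ℕ.≤ c → f c ≡ true) → count f n ≡ n ∸ m
count-upper zero    m _ _    _   = sym (ℕP.0∸n≡0 m)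
count-upper (suc n) m f below above with m ℕ.≤? n
... | yes m≤n rewrite above n ℕP.≤-refl m≤n =
  trans (cong suc (count-upper n m f (λ c c<n → below c (ℕP.m<n⇒m<1+n c<n)) (λ c c<n → above c (ℕP.m<n⇒m<1+n c<n))))
        (sym (ℕP.+-∸-assoc 1 m≤n))
... | no m≰n rewrite below n ℕP.≤-refl (ℕP.≰⇒> m≰n) =
  trans (count-upper n m f (λ c c<n → below c (ℕP.m<n⇒m<1+n c<n)) (λ c c<n → above c (ℕP.m<n⇒m<1+n c<n)))
        (trans (ℕP.m≤n⇒m∸n≡0 (ℕP.≰⇒≥ m≰n)) (sym (ℕP.m≤n⇒m∸n≡0 (ℕP.≰⇒> m≰n))))

count-+ : ∀ n (f g h : ℕ → Bool) → (∀ c → bit (f c) ≡ bit (g c) ℕ.+ bit (h c)) → count f n ≡ count g n ℕ.+ count h n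
count-+ zero    _ _ _ _     = refl
count-+ (suc n) f g h split =
  trans (cong₂ ℕ._+_ (split n) (count-+ n f g h split)) (+-interchange (bit (g n)) (bit (h n)) (count g n) (count h n))

∣l-r∣≡d∸c : ∀ {l r c d} → c ℕ.≤ d → l ℕ.+ c ≡ r ℕ.+ d → ∣ l - r ∣ ≡ d ∸ c
∣l-r∣≡d∸c {l} {r} {c} {d} c≤d l+c≡r+d =
  trans (cong (λ x → ∣ x - r ∣) l≡r+[d∸c]) (trans (ℕP.∣-∣-comm (r ℕ.+ (d ∸ c)) r) (ℕP.∣m-m+n∣≡n r (d ∸ c)))
  where
  l≡r+[d∸c] : l ≡ r ℕ.+ (d ∸ c)
  l≡r+[d∸c] = ℕP.+-cancelʳ-≡ c l (r ℕ.+ (d ∸ c))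
                (trans l+c≡r+d (trans (cong (r ℕ.+_) (sym (ℕP.m∸n+n≡m c≤d))) (sym (ℕP.+-assoc r (d ∸ c) c))))

∣r+c-[r+d]∣≡d∸c : ∀ r {c d} → c ℕ.≤ d → ∣ r ℕ.+ c - r ℕ.+ d ∣ ≡ d ∸ c
∣r+c-[r+d]∣≡d∸c r {c} {d} c≤d =
  trans (ℕP.∣m+n-m+o∣≡∣n-o∣ r c d) (trans (ℕP.∣-∣-comm c d) (ℕP.m≤n⇒∣n-m∣≡n∸m c≤d))

p∸[1+a]≡p∸[1+b]+[b∸a] : ∀ {p a b} → a ℕ.≤ b → b ℕ.< p → p ∸ suc a ≡ (p ∸ suc b) ℕ.+ (b ∸ a)
p∸[1+a]≡p∸[1+b]+[b∸a] {p} {a} {b} a≤b b<p =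
  trans (cong (_∸ suc a) (sym (ℕP.m∸n+n≡m b<p))) (ℕP.+-∸-assoc (p ∸ suc b) (s≤s a≤b))

bit≤1 : ∀ c → bit c ℕ.≤ 1
bit≤1 true  = s≤s z≤n
bit≤1 false = z≤n

odd⇒[n∸1]/2+[n∸1]/2≡n∸1 : ∀ n → n ℕ.% 2 ≡ 1 → (n ∸ 1) ℕ./ 2 ℕ.+ (n ∸ 1) ℕ./ 2 ≡ n ∸ 1
odd⇒[n∸1]/2+[n∸1]/2≡n∸1 n n-odd = begin
  (n ∸ 1) ℕ./ 2 ℕ.+ (n ∸ 1) ℕ./ 2 ≡⟨ cong (λ m → m ℕ./ 2 ℕ.+ m ℕ./ 2) n∸1≡[n/2]*2 ⟩
  n/2*2 ℕ./ 2 ℕ.+ n/2*2 ℕ./ 2     ≡⟨ cong₂ ℕ._+_ (m*n/n≡m (n ℕ./ 2) 2) (m*n/n≡m (n ℕ./ 2) 2) ⟩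
  n ℕ./ 2 ℕ.+ n ℕ./ 2             ≡⟨ by-ring (n ℕ./ 2) ⟩
  n/2*2                           ≡⟨ n∸1≡[n/2]*2 ⟨
  n ∸ 1                           ∎
  where
  open ≡-Reasoning
  n/2*2 = n ℕ./ 2 ℕ.* 2
  n∸1≡[n/2]*2 : n ∸ 1 ≡ n/2*2
  n∸1≡[n/2]*2 = cong (_∸ 1) (trans (m≡m%n+[m/n]*n n 2) (cong (ℕ._+ n/2*2) n-odd))
  by-ring : ∀ m → m ℕ.+ m ≡ m ℕ.* 2
  by-ring = NS.solve-∀

module Abacus where

  open import Data.Integer as ℤ using (ℤ; +_; -[1+_]; _+_; _-_; -_; _<_; _≤_; _≮_; +≤+; +<+)

  ≡⇒=ᶻ : ∀ {x y} → x ≡ y → (x =ᶻ y) ≡ true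
  ≡⇒=ᶻ {x} refl = dec-true (x ℤP.≟ x) refl

  ≢⇒=ᶻ : ∀ {x y} → x ≢ y → (x =ᶻ y) ≡ false
  ≢⇒=ᶻ {x} {y} = dec-false (x ℤP.≟ y)

  =ᶻ⇒≡ : ∀ {x y} → (x =ᶻ y) ≡ true → x ≡ y
  =ᶻ⇒≡ {x} {y} e with x ℤP.≟ y
  ... | yes x≡y = x≡y

  <⇒<ᶻ : ∀ {x y} → x < y → (x <ᶻ y) ≡ true
  <⇒<ᶻ {x} {y} = dec-true (x ℤP.<? y)

  ≮⇒<ᶻ : ∀ {x y} → x ≮ y → (x <ᶻ y) ≡ false
  ≮⇒<ᶻ {x} {y} = dec-false (x ℤP.<? y)

  <ᶻ⇒< : ∀ {x y} → (x <ᶻ y) ≡ true → x < y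
  <ᶻ⇒< {x} {y} e with x ℤP.<? y
  ... | yes x<y = x<y

  <ᶻ⇒≮ : ∀ {x y} → (x <ᶻ y) ≡ false → x ≮ y
  <ᶻ⇒≮ {x} {y} e with x ℤP.<? y
  ... | no x≮y = x≮y

  +-cancelʳ-≡ : ∀ {x y} c → x + c ≡ y + c → x ≡ y
  +-cancelʳ-≡ {x} {y} c = ∙-cancelʳ c x y

  i+j-j≡i : ∀ i j → i + j - j ≡ i
  i+j-j≡i = solve-∀

  i-j+j≡i : ∀ i j → i - j + j ≡ i
  i-j+j≡i = solve-∀

  i+j-i≡j : ∀ i j → i + j - i ≡ j
  i+j-i≡j = solve-∀

  i+[j-i]≡j : ∀ i j → i + (j - i) ≡ j
  i+[j-i]≡j = solve-∀

  +-cancelʳ-< : ∀ {x y} c → x + c < y + c → x < y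
  +-cancelʳ-< {x} {y} c x+c<y+c = subst₂ _<_ (i+j-j≡i x c) (i+j-j≡i y c) (ℤP.+-monoˡ-< (- c) x+c<y+c)

  <⇒+1≤ : ∀ {x y} → x < y → x + + 1 ≤ y
  <⇒+1≤ {x} {y} x<y = subst (_≤ y) (ℤP.+-comm (+ 1) x) (ℤP.i<j⇒suc[i]≤j x<y)

  +1≤⇒< : ∀ {x y} → x + + 1 ≤ y → x < y
  +1≤⇒< {x} {y} x+1≤y = ℤP.suc[i]≤j⇒i<j (subst (_≤ y) (ℤP.+-comm x (+ 1)) x+1≤y)

  i<i+1+n : ∀ x n → x < x + + suc n
  i<i+1+n x n = +1≤⇒< (ℤP.+-monoʳ-≤ x (+≤+ (s≤s z≤n)))

  i-1+n<i : ∀ x n → x - + suc n < x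
  i-1+n<i x n = subst (x - + suc n <_) (i-j+j≡i x (+ suc n)) (i<i+1+n (x - + suc n) n)

  i<i+1 : ∀ x → x < x + + 1
  i<i+1 x = i<i+1+n x 0

  i-1<i : ∀ x → x - + 1 < x
  i-1<i x = i-1+n<i x 0

  <∧+1≢⇒+1< : ∀ {x y} → x < y → x + + 1 ≢ y → x + + 1 < y
  <∧+1≢⇒+1< x<y = ℤP.≤∧≢⇒< (<⇒+1≤ x<y)

  <⇒≢ : ∀ {x y} → x < y → x ≢ y
  <⇒≢ = ℤP.<⇒≢

  >⇒≢ : ∀ {x y} → y < x → x ≢ y
  >⇒≢ y<x = ℤP.<⇒≢ y<x ∘ sym

  =ᶻ-shift : ∀ x y → (x =ᶻ y) ≡ ((x + + 1) =ᶻ (y + + 1))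
  =ᶻ-shift x y with x ℤP.≟ y
  ... | yes refl = sym (≡⇒=ᶻ {x + + 1} refl)
  ... | no x≢y = sym (≢⇒=ᶻ (x≢y ∘ +-cancelʳ-≡ (+ 1)))

  <ᶻ-shift : ∀ x y → (x <ᶻ y) ≡ ((x + + 1) <ᶻ (y + + 1))
  <ᶻ-shift x y with x ℤP.<? y
  ... | yes x<y = sym (<⇒<ᶻ (ℤP.+-monoˡ-< (+ 1) x<y))
  ... | no x≮y = sym (≮⇒<ᶻ (x≮y ∘ +-cancelʳ-< (+ 1)))

  <⊎≥ : ∀ x y → x < y ⊎ y ≤ x
  <⊎≥ x y with ℤP.<-cmp x y
  ... | tri< x<y _ _ = inj₁ x<y
  ... | tri≈ _ x≡y _ = inj₂ (ℤP.≤-reflexive (sym x≡y))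
  ... | tri> _ _ y<x = inj₂ (ℤP.<⇒≤ y<x)

  ≡-or-≢ : ∀ (x y : ℤ) → x ≡ y ⊎ x ≢ y
  ≡-or-≢ x y with x ℤP.≟ y
  ... | yes x≡y = inj₁ x≡y
  ... | no x≢y = inj₂ x≢y

  mv-to : ∀ S f t → mv S f t t ≡ true
  mv-to S f t rewrite ≡⇒=ᶻ (refl {x = t}) = refl

  mv-from : ∀ S {f t} → f ≢ t → mv S f t f ≡ false
  mv-from S {f} f≢t rewrite ≢⇒=ᶻ f≢t | ≡⇒=ᶻ (refl {x = f}) = refl

  mv-other : ∀ S {f t z} → z ≢ t → z ≢ f → mv S f t z ≡ S z
  mv-other S z≢t z≢f rewrite ≢⇒=ᶻ z≢t | ≢⇒=ᶻ z≢f = refl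

  mv-cong : ∀ {S T} f t → S ≗ T → mv S f t ≗ mv T f t
  mv-cong f t S≗T z with z =ᶻ t | z =ᶻ f
  ... | true  | _     = refl
  ... | false | true  = refl
  ... | false | false = S≗T z

  mv-undo : ∀ S {f t} → S f ≡ true → S t ≡ false → f ≢ t → mv (mv S f t) t f ≗ S
  mv-undo S {f} {t} Sf St f≢t z with ≡-or-≢ z f | ≡-or-≢ z t
  ... | inj₁ refl | _         = trans (mv-to (mv S z t) t z) (sym Sf)
  ... | inj₂ _    | inj₁ refl = trans (mv-from (mv S f z) (f≢t ∘ sym)) (sym St)
  ... | inj₂ z≢f  | inj₂ z≢t  = trans (mv-other (mv S f t) z≢f z≢t) (mv-other S z≢t z≢f)

  mv-via-empty : ∀ S {x m y} → S m ≡ false → x ≢ m → m ≢ y → x ≢ y → mv (mv S x m) m y ≗ mv S x y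
  mv-via-empty S {x} {m} {y} Sm x≢m m≢y x≢y z with ≡-or-≢ z y | ≡-or-≢ z m | ≡-or-≢ z x
  ... | inj₁ refl | _         | _         = trans (mv-to (mv S x m) m z) (sym (mv-to S x z))
  ... | inj₂ z≢y  | inj₁ refl | _         = trans (mv-from (mv S x z) m≢y) (trans (sym Sm) (sym (mv-other S z≢y (x≢m ∘ sym))))
  ... | inj₂ z≢y  | inj₂ z≢m  | inj₁ refl = trans (mv-other (mv S z m) z≢y z≢m) (trans (mv-from S x≢m) (sym (mv-from S x≢y)))
  ... | inj₂ z≢y  | inj₂ z≢m  | inj₂ z≢x  =
    trans (mv-other (mv S x m) z≢y z≢m) (trans (mv-other S z≢m z≢x) (sym (mv-other S z≢y z≢x)))

  mv-via-full : ∀ S {x m y} → S m ≡ true → S y ≡ false → x ≢ m → m ≢ y → x ≢ y → mv (mv S m y) x m ≗ mv S x y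
  mv-via-full S {x} {m} {y} Sm Sy x≢m m≢y x≢y z with ≡-or-≢ z m | ≡-or-≢ z x | ≡-or-≢ z y
  ... | inj₁ refl | _         | _         = trans (mv-to (mv S z y) x z) (trans (sym Sm) (sym (mv-other S m≢y (x≢m ∘ sym))))
  ... | inj₂ z≢m  | inj₁ refl | _         = trans (mv-from (mv S m y) x≢m) (sym (mv-from S x≢y))
  ... | inj₂ z≢m  | inj₂ z≢x  | inj₁ refl = trans (mv-other (mv S m z) z≢m z≢x) (trans (mv-to S m z) (sym (mv-to S x z)))
  ... | inj₂ z≢m  | inj₂ z≢x  | inj₂ z≢y  =
    trans (mv-other (mv S m y) z≢m z≢x) (trans (mv-other S z≢y z≢m) (sym (mv-other S z≢y z≢x)))

  mv-shift : ∀ S f t y → mv S (f + + 1) (t + + 1) (y + + 1) ≡ mv (S ∘ (_+ + 1)) f t y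
  mv-shift S f t y rewrite sym (=ᶻ-shift y t) | sym (=ᶻ-shift y f) = refl

  insertBead : ℤ → (ℤ → Bool) → ℤ → Bool
  insertBead f B y = (y =ᶻ f) ∨ B y

  mv-insertBead : ∀ B {f t} → B f ≡ false → B t ≡ false → mv (insertBead f B) f t ≗ insertBead t B
  mv-insertBead B {f} {t} Bf Bt y with ≡-or-≢ y t | ≡-or-≢ y f
  ... | inj₁ refl | _         = trans (mv-to (insertBead f B) f y) (sym (cong (_∨ B y) (≡⇒=ᶻ {y} refl)))
  ... | inj₂ y≢t  | inj₁ refl = trans (mv-from (insertBead y B) y≢t) (sym (cong₂ _∨_ (≢⇒=ᶻ y≢t) Bf))
  ... | inj₂ y≢t  | inj₂ y≢f  = trans (mv-other (insertBead f B) y≢t y≢f)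
                                       (trans (cong (_∨ B y) (≢⇒=ᶻ y≢f)) (sym (cong (_∨ B y) (≢⇒=ᶻ y≢t))))

  mv-insertBead-other : ∀ B {c f t} → c ≢ f → c ≢ t → mv (insertBead c B) f t ≗ insertBead c (mv B f t)
  mv-insertBead-other B {c} {f} {t} c≢f c≢t y with ≡-or-≢ y t | ≡-or-≢ y f
  ... | inj₁ refl | _         = trans (mv-to (insertBead c B) f y) (sym (trans (cong (_∨ mv B f y y) (≢⇒=ᶻ (c≢t ∘ sym))) (mv-to B f y)))
  ... | inj₂ y≢t  | inj₁ refl = trans (mv-from (insertBead c B) y≢t) (sym (cong₂ _∨_ (≢⇒=ᶻ (c≢f ∘ sym)) (mv-from B y≢t)))
  ... | inj₂ y≢t  | inj₂ y≢f  = trans (mv-other (insertBead c B) y≢t y≢f) (sym (cong ((y =ᶻ c) ∨_) (mv-other B y≢t y≢f)))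

  mv-below : ∀ S {f t c} → (∀ z → S z ≡ true → z < c) → t < c → ∀ z → mv S f t z ≡ true → z < c
  mv-below S {f} {t} S<c t<c z mvz with ≡-or-≢ z t | ≡-or-≢ z f
  ... | inj₁ refl | _         = t<c
  ... | inj₂ z≢t  | inj₁ refl = ⊥-elim (true≢false (trans (sym mvz) (mv-from S z≢t)))
  ... | inj₂ z≢t  | inj₂ z≢f  = S<c z (trans (sym (mv-other S z≢t z≢f)) mvz)

  beads : List ℕ → ℤ → Bool
  beads []      = _<ᶻ (+ 0)
  beads (a ∷ l) = insertBead (+ a - + 1) (beads l ∘ (_+ + 1))

  bead≗beads : ∀ l → bead l ≗ beads l
  bead≗beads []      x = ∨-identityʳ _
  bead≗beads (a ∷ l) x =
    trans (∨-swap (x <ᶻ (- (+ suc n))) (x =ᶻ (+ a - + 1)) _)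
          (cong ((x =ᶻ (+ a - + 1)) ∨_) (trans (cong₂ _∨_ below-shift parts-shift) (bead≗beads l (x + + 1))))
    where
    n = length l
    ∨-swap : ∀ a b c → a ∨ (b ∨ c) ≡ b ∨ (a ∨ c)
    ∨-swap true  true  _ = refl
    ∨-swap true  false _ = refl
    ∨-swap false _     _ = refl
    below-shift : (x <ᶻ (- (+ suc n))) ≡ ((x + + 1) <ᶻ (- (+ n)))
    below-shift = trans (<ᶻ-shift x _) (cong ((x + + 1) <ᶻ_) (by-ring (+ n)))
      where
      by-ring : ∀ m → - (+ 1 + m) + + 1 ≡ - m
      by-ring = solve-∀
    any-cong : ∀ P Q (f g : ℕ → ℕ) m → (∀ j → P (f j) ≡ Q (g j)) → any P (applyUpTo f m) ≡ any Q (applyUpTo g m)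
    any-cong P Q f g zero    _   = refl
    any-cong P Q f g (suc m) P≡Q = cong₂ _∨_ (P≡Q 0) (any-cong P Q (f ∘ suc) (g ∘ suc) m (P≡Q ∘ suc))
    parts-shift : any (λ i → x =ᶻ (+ part (a ∷ l) i - + i)) (applyUpTo (suc ∘ suc) n)
                ≡ any (λ i → (x + + 1) =ᶻ (+ part l i - + i)) (applyUpTo suc n)
    parts-shift = any-cong _ _ _ _ n (λ j → trans (=ᶻ-shift x _) (cong ((x + + 1) =ᶻ_) (by-ring (+ nth l j) (+ suc j))))
      where
      by-ring : ∀ c m → c - (+ 1 + m) + + 1 ≡ c - m
      by-ring = solve-∀

  IsPartitionʳ : List ℕ → Set
  IsPartitionʳ []      = ⊤
  IsPartitionʳ (a ∷ l) = 0 ℕ.< a × part l 1 ℕ.≤ a × IsPartitionʳ l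

  IsPartition⇒IsPartitionʳ : ∀ l → IsPartition l → IsPartitionʳ l
  IsPartition⇒IsPartitionʳ []          _                 = tt
  IsPartition⇒IsPartitionʳ (a ∷ [])    (0<a ∷ [] , _)     = 0<a , z≤n , tt
  IsPartition⇒IsPartitionʳ (a ∷ b ∷ l) (0<a ∷ 0<l , a≥b ∷ ≥l) = 0<a , a≥b , IsPartition⇒IsPartitionʳ (b ∷ l) (0<l , ≥l)

  IsPartitionʳ⇒IsPartition : ∀ l → IsPartitionʳ l → IsPartition l
  IsPartitionʳ⇒IsPartition []          _                = [] , []
  IsPartitionʳ⇒IsPartition (a ∷ [])    (0<a , _ , _)    = 0<a ∷ [] , [-]
  IsPartitionʳ⇒IsPartition (a ∷ b ∷ l) (0<a , b≤a , pl) with IsPartitionʳ⇒IsPartition (b ∷ l) pl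
  ... | 0<l , ≥l = 0<a ∷ 0<l , b≤a ∷ ≥l

  insertBead-cong : ∀ c {B B′ : ℤ → Bool} → B ≗ B′ → insertBead c B ≗ insertBead c B′
  insertBead-cong c B≗B′ y = cong ((y =ᶻ c) ∨_) (B≗B′ y)

  beads-head : ∀ a l → beads (a ∷ l) (+ a - + 1) ≡ true
  beads-head a l = cong (_∨ beads l (+ a - + 1 + + 1)) (≡⇒=ᶻ {+ a - + 1} refl)

  beads-below : ∀ l → IsPartitionʳ l → ∀ z → beads l z ≡ true → z < + part l 1
  beads-below []      _              z bz = <ᶻ⇒< bz
  beads-below (a ∷ l) (_ , l≤a , pl) z bz with ∨-true-⊎ (z =ᶻ (+ a - + 1)) _ bz
  ... | inj₁ z≡X = subst (_< + a) (sym (=ᶻ⇒≡ z≡X)) (i-1<i (+ a))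
  ... | inj₂ bl  = ℤP.<-trans (i<i+1 z) (ℤP.<-≤-trans (beads-below l pl (z + + 1) bl) (+≤+ l≤a))

  part₁-≤ : ∀ l a → (∀ z → beads l z ≡ true → z < + a) → part l 1 ℕ.≤ a
  part₁-≤ []      a _     = z≤n
  part₁-≤ (b ∷ l) a l<a = ℤP.drop‿+≤+ (subst (_≤ + a) (i-j+j≡i (+ b) (+ 1)) (<⇒+1≤ (l<a (+ b - + 1) (beads-head b l))))

  part₁-≤-pred : ∀ l c → part l 1 ℕ.≤ suc c → beads l (+ c) ≡ false → part l 1 ℕ.≤ c
  part₁-≤-pred []      c _   _   = z≤n
  part₁-≤-pred (b ∷ l) c b≤c bc = ℕP.≤-pred (ℕP.≤∧≢⇒< b≤c b≢1+c)
    where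
    b≢1+c : b ≢ suc c
    b≢1+c refl = true≢false (trans (sym (beads-head b l)) bc)

  beads-[]≗beads-[0] : beads [] ≗ beads (0 ∷ [])
  beads-[]≗beads-[0] y with ℤP.<-cmp y -[1+ 0 ]
  ... | tri< y<⁻1 _ _ = trans (<⇒<ᶻ (ℤP.<-trans y<⁻1 ℤ.-<+))
                              (sym (cong₂ _∨_ (≢⇒=ᶻ (<⇒≢ y<⁻1)) (<⇒<ᶻ (ℤP.+-monoˡ-< (+ 1) y<⁻1))))
  ... | tri≈ _ refl _ = refl
  ... | tri> _ _ y>⁻1 = trans (≮⇒<ᶻ (ℤP.≤⇒≯ (<⇒+1≤ y>⁻1)))
                              (sym (cong₂ _∨_ (≢⇒=ᶻ (>⇒≢ y>⁻1)) (≮⇒<ᶻ (λ y+1<0 → ℤP.<-asym y>⁻1 (+-cancelʳ-< (+ 1) y+1<0)))))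

  beads-∷-mv : ∀ a l l′ {x t} → beads l′ ≗ mv (beads l) (x + + 1) (t + + 1) →
               + a - + 1 ≢ x → + a - + 1 ≢ t → beads (a ∷ l′) ≗ mv (beads (a ∷ l)) x t
  beads-∷-mv a l l′ {x} {t} l′≗ X≢x X≢t y =
    trans (insertBead-cong (+ a - + 1) (λ z → trans (l′≗ (z + + 1)) (mv-shift (beads l) x t z)) y)
          (sym (mv-insertBead-other (beads l ∘ (_+ + 1)) X≢x X≢t y))

  part₁-mv-≤ : ∀ l l′ {f t a} → IsPartitionʳ l → part l 1 ℕ.≤ a → t < + a →
               beads l′ ≗ mv (beads l) f t → part l′ 1 ℕ.≤ a
  part₁-mv-≤ l l′ {f} {t} {a} pl l≤a t<a l′≗ = part₁-≤ l′ a λ z bz →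
    mv-below (beads l) (λ w bw → ℤP.<-≤-trans (beads-below l pl w bw) (+≤+ l≤a)) t<a z (trans (sym (l′≗ z)) bz)

  +1≡⇒≡-1 : ∀ {x y} → x + + 1 ≡ y → x ≡ y - + 1
  +1≡⇒≡-1 {x} {y} x+1≡y = trans (sym (i+j-j≡i x (+ 1))) (cong (_- + 1) x+1≡y)

  =ᶻ-false⇒≢ : ∀ {x y} → (x =ᶻ y) ≡ false → x ≢ y
  =ᶻ-false⇒≢ e x≡y = true≢false (trans (sym (≡⇒=ᶻ x≡y)) e)

  beads-∷-tail : ∀ a l {x} → beads (a ∷ l) x ≡ true → x ≢ + a - + 1 → beads l (x + + 1) ≡ true
  beads-∷-tail a l {x} bx x≢X with ∨-true-⊎ (x =ᶻ (+ a - + 1)) _ bx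
  ... | inj₁ x≡X = ⊥-elim (x≢X (=ᶻ⇒≡ x≡X))
  ... | inj₂ b   = b

  beads-≥ : ∀ l → IsPartitionʳ l → ∀ {z} → + part l 1 ≤ z → beads l z ≡ false
  beads-≥ l pl l≤z = ¬-not λ bz → ℤP.≤⇒≯ l≤z (beads-below l pl _ bz)

  beads-[]-top : ∀ x → beads [] x ≡ true → beads [] (x + + 1) ≡ false → x ≡ -[1+ 0 ]
  beads-[]-top x bx bx+1 = +1≡⇒≡-1 (ℤP.≤-antisym (<⇒+1≤ (<ᶻ⇒< {x} bx)) (ℤP.≮⇒≥ (<ᶻ⇒≮ {x + + 1} bx+1)))

  Realisable : (ℤ → Bool) → Set
  Realisable S = Σ (List ℕ) λ l → IsPartitionʳ l × beads l ≗ S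

  Realisation : ℕ → (ℤ → Bool) → Set
  Realisation n S = Σ (List ℕ) λ l → IsPartitionʳ l × sum l ≡ n × beads l ≗ S

  beads-slideUp₁ : ∀ l → IsPartitionʳ l → ∀ x → beads l x ≡ true → beads l (x + + 1) ≡ false →
                   Realisation (suc (sum l)) (mv (beads l) x (x + + 1))
  beads-slideUp₁ [] _ x bx bx+1 with beads-[]-top x bx bx+1
  ... | refl = 1 ∷ [] , (s≤s z≤n , z≤n , tt) , refl , λ y →
    trans (sym (mv-insertBead (beads [] ∘ (_+ + 1)) refl refl y)) (sym (mv-cong -[1+ 0 ] (+ 0) beads-[]≗beads-[0] y))
  beads-slideUp₁ (a ∷ l) (0<a , l≤a , pl) x bx bx+1 with ≡-or-≢ x (+ a - + 1)
  ... | inj₁ refl = suc a ∷ l , (s≤s z≤n , ℕP.m≤n⇒m≤1+n l≤a , pl) , refl , λ y →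
    trans (cong (λ t → insertBead t B y) (sym (i-j+j≡i (+ a) (+ 1)))) (sym (mv-insertBead B Ba (∨-conicalʳ _ _ bx+1) y))
    where
    B = beads l ∘ (_+ + 1)
    Ba : beads l (+ a - + 1 + + 1) ≡ false
    Ba = beads-≥ l pl (subst (_ ≤_) (sym (i-j+j≡i (+ a) (+ 1))) (+≤+ l≤a))
  ... | inj₂ x≢X with beads-slideUp₁ l pl (x + + 1) (beads-∷-tail a l bx x≢X) (∨-conicalʳ _ _ bx+1)
  ...   | l′ , pl′ , size , l′≗ =
    a ∷ l′ , (0<a , part₁-mv-≤ l l′ pl l≤a x+2<a l′≗ , pl′) , trans (cong (a ℕ.+_) size) (ℕP.+-suc a (sum l)) ,
    beads-∷-mv a l l′ l′≗ (x≢X ∘ sym) (x+1≢X ∘ sym)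
    where
    x+1≢X : x + + 1 ≢ + a - + 1
    x+1≢X = =ᶻ-false⇒≢ (∨-conicalˡ _ _ bx+1)
    x+2<a : x + + 1 + + 1 < + a
    x+2<a = <∧+1≢⇒+1< (<∧+1≢⇒+1< (beads-below (a ∷ l) (0<a , l≤a , pl) x bx) (x≢X ∘ +1≡⇒≡-1)) (x+1≢X ∘ +1≡⇒≡-1)

  i-1+1≡i+1-1 : ∀ x → x - + 1 + + 1 ≡ x + + 1 - + 1
  i-1+1≡i+1-1 = solve-∀

  beads-slideDown₁ : ∀ l → IsPartitionʳ l → ∀ x → beads l x ≡ true → beads l (x - + 1) ≡ false →
                     Realisable (mv (beads l) x (x - + 1))
  beads-slideDown₁ [] _ x bx bx-1 = ⊥-elim (<ᶻ⇒≮ {x - + 1} bx-1 (ℤP.<-trans (i-1<i x) (<ᶻ⇒< {x} bx)))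
  beads-slideDown₁ (a ∷ l) (0<a , l≤a , pl) x bx bx-1 with ≡-or-≢ x (+ a - + 1)
  beads-slideDown₁ (suc zero ∷ []) _ x bx bx-1 | inj₁ refl = [] , tt , λ y →
    trans (beads-[]≗beads-[0] y) (sym (mv-insertBead (beads [] ∘ (_+ + 1)) refl refl y))
  beads-slideDown₁ (suc zero ∷ b ∷ l) (_ , b≤1 , 0<b , _) x bx bx-1 | inj₁ refl =
    ⊥-elim (ℕP.<⇒≱ 0<b (part₁-≤-pred (b ∷ l) 0 b≤1 (∨-conicalʳ ((+ 0 - + 1) =ᶻ (+ 1 - + 1)) _ bx-1)))
  beads-slideDown₁ (suc (suc a) ∷ l) (_ , l≤a , pl) x bx bx-1 | inj₁ refl =
    suc a ∷ l , (s≤s z≤n , part₁-≤-pred l (suc a) l≤a l-free , pl) , λ y →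
    sym (mv-insertBead (beads l ∘ (_+ + 1)) l-free′ (∨-conicalʳ _ _ bx-1) y)
    where
    l-free′ : beads l (+ suc (suc a) - + 1 + + 1) ≡ false
    l-free′ = beads-≥ l pl (subst (+ part l 1 ≤_) (sym (i-j+j≡i _ (+ 1))) (+≤+ l≤a))
    l-free : beads l (+ suc a) ≡ false
    l-free = trans (cong (λ n → beads l (+ n)) (sym (ℕP.+-comm a 1))) (∨-conicalʳ _ _ bx-1)
  ... | inj₂ x≢X with beads-slideDown₁ l pl (x + + 1) (beads-∷-tail a l bx x≢X)
                                        (subst (λ z → beads l z ≡ false) (i-1+1≡i+1-1 x) (∨-conicalʳ _ _ bx-1))
  ...   | l′ , pl′ , l′≗ =
    a ∷ l′ , (0<a , part₁-mv-≤ l l′ pl l≤a x-1<a l′≗′ , pl′) , beads-∷-mv a l l′ l′≗′ (x≢X ∘ sym) (x-1≢X ∘ sym)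
    where
    l′≗′ : beads l′ ≗ mv (beads l) (x + + 1) (x - + 1 + + 1)
    l′≗′ y = trans (l′≗ y) (cong (λ t → mv (beads l) (x + + 1) t y) (sym (i-1+1≡i+1-1 x)))
    x-1≢X : x - + 1 ≢ + a - + 1
    x-1≢X = =ᶻ-false⇒≢ (∨-conicalˡ _ _ bx-1)
    x-1<a : x - + 1 + + 1 < + a
    x-1<a = subst (_< + a) (sym (i-j+j≡i x (+ 1))) (beads-below (a ∷ l) (0<a , l≤a , pl) x bx)

  i+[1+n]+1≡i+[2+n] : ∀ x n → x + + suc n + + 1 ≡ x + + suc (suc n)
  i+[1+n]+1≡i+[2+n] x n = by-ring x (+ n)
    where
    by-ring : ∀ x D → x + (+ 1 + D) + + 1 ≡ x + (+ 1 + (+ 1 + D))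
    by-ring = solve-∀

  i-[1+n]-1≡i-[2+n] : ∀ x n → x - + suc n - + 1 ≡ x - + suc (suc n)
  i-[1+n]-1≡i-[2+n] x n = by-ring x (+ n)
    where
    by-ring : ∀ x D → x - (+ 1 + D) - + 1 ≡ x - (+ 1 + (+ 1 + D))
    by-ring = solve-∀

  slideUp₁ : ∀ {n S x} → Realisation n S → S x ≡ true → S (x + + 1) ≡ false → Realisation (suc n) (mv S x (x + + 1))
  slideUp₁ {x = x} (l , pl , refl , l≗) Sx Sx+1 with beads-slideUp₁ l pl x (trans (l≗ x) Sx) (trans (l≗ _) Sx+1)
  ... | l′ , pl′ , size , l′≗ = l′ , pl′ , size , λ y → trans (l′≗ y) (mv-cong x (x + + 1) l≗ y)

  slideDown₁ : ∀ {S x} → Realisable S → S x ≡ true → S (x - + 1) ≡ false → Realisable (mv S x (x - + 1))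
  slideDown₁ {x = x} (l , pl , l≗) Sx Sx-1 with beads-slideDown₁ l pl x (trans (l≗ x) Sx) (trans (l≗ _) Sx-1)
  ... | l′ , pl′ , l′≗ = l′ , pl′ , λ y → trans (l′≗ y) (mv-cong x (x - + 1) l≗ y)

  slideUp-via : ∀ {k n S x m} → x < m →
                (∀ {n′ T} → Realisation n′ T → T x ≡ true → T m ≡ false → Realisation (n′ ℕ.+ k) (mv T x m)) →
                Realisation n S → S x ≡ true → S (m + + 1) ≡ false → Realisation (n ℕ.+ suc k) (mv S x (m + + 1))
  slideUp-via {k} {n} {S} {x} {m} x<m slide r Sx Sy with S m in Sm
  ... | false with slideUp₁ (slide r Sx Sm) (mv-to S x m) (trans (mv-other S (>⇒≢ (i<i+1 m)) (>⇒≢ (ℤP.<-trans x<m (i<i+1 m)))) Sy)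
  ...   | l , pl , size , l≗ = l , pl , trans size (sym (ℕP.+-suc n k)) , λ z →
    trans (l≗ z) (mv-via-empty S Sm (<⇒≢ x<m) (<⇒≢ (i<i+1 m)) (<⇒≢ (ℤP.<-trans x<m (i<i+1 m))) z)
  slideUp-via {k} {n} {S} {x} {m} x<m slide r Sx Sy | true
    with slide (slideUp₁ r Sm Sy) (trans (mv-other S (<⇒≢ (ℤP.<-trans x<m (i<i+1 m))) (<⇒≢ x<m)) Sx) (mv-from S (<⇒≢ (i<i+1 m)))
  ... | l , pl , size , l≗ = l , pl , trans size (sym (ℕP.+-suc n k)) , λ z →
    trans (l≗ z) (mv-via-full S Sm Sy (<⇒≢ x<m) (<⇒≢ (i<i+1 m)) (<⇒≢ (ℤP.<-trans x<m (i<i+1 m))) z)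

  slideDown-via : ∀ {S x m} → m < x →
                  (∀ {T} → Realisable T → T x ≡ true → T m ≡ false → Realisable (mv T x m)) →
                  Realisable S → S x ≡ true → S (m - + 1) ≡ false → Realisable (mv S x (m - + 1))
  slideDown-via {S} {x} {m} m<x slide r Sx Sy with S m in Sm
  ... | false with slideDown₁ (slide r Sx Sm) (mv-to S x m) (trans (mv-other S (<⇒≢ (i-1<i m)) (<⇒≢ (ℤP.<-trans (i-1<i m) m<x))) Sy)
  ...   | l , pl , l≗ = l , pl , λ z →
    trans (l≗ z) (mv-via-empty S Sm (>⇒≢ m<x) (>⇒≢ (i-1<i m)) (>⇒≢ (ℤP.<-trans (i-1<i m) m<x)) z)
  slideDown-via {S} {x} {m} m<x slide r Sx Sy | true
    with slide (slideDown₁ r Sm Sy) (trans (mv-other S (>⇒≢ (ℤP.<-trans (i-1<i m) m<x)) (>⇒≢ m<x)) Sx) (mv-from S (>⇒≢ (i-1<i m)))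
  ... | l , pl , l≗ = l , pl , λ z →
    trans (l≗ z) (mv-via-full S Sm Sy (>⇒≢ m<x) (>⇒≢ (i-1<i m)) (>⇒≢ (ℤP.<-trans (i-1<i m) m<x)) z)

  slideUp : ∀ d {n S x} → Realisation n S → S x ≡ true → S (x + + suc d) ≡ false →
            Realisation (n ℕ.+ suc d) (mv S x (x + + suc d))
  slideUp zero {n} {S} {x} r Sx Sy = subst (λ k → Realisation k (mv S x (x + + 1))) (ℕP.+-comm 1 n) (slideUp₁ r Sx Sy)
  slideUp (suc d) {S = S} {x} r Sx Sy =
    subst (λ t → Realisation _ (mv S x t)) (i+[1+n]+1≡i+[2+n] x d)
          (slideUp-via (i<i+1+n x d) (slideUp d) r Sx (subst (λ t → S t ≡ false) (sym (i+[1+n]+1≡i+[2+n] x d)) Sy))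

  slideDown : ∀ d {S x} → Realisable S → S x ≡ true → S (x - + suc d) ≡ false → Realisable (mv S x (x - + suc d))
  slideDown zero r Sx Sy = slideDown₁ r Sx Sy
  slideDown (suc d) {S} {x} r Sx Sy =
    subst (λ t → Realisable (mv S x t)) (i-[1+n]-1≡i-[2+n] x d)
          (slideDown-via (i-1+n<i x d) (slideDown d) r Sx (subst (λ t → S t ≡ false) (sym (i-[1+n]-1≡i-[2+n] x d)) Sy))

  realisation : ∀ ν → IsPartition ν → Realisation (size ν) (bead ν)
  realisation ν ν-partition = ν , IsPartition⇒IsPartitionʳ ν ν-partition , refl , λ y → sym (bead≗beads ν y)

  from-realisation : ∀ {n S} → Realisation n S → Σ (List ℕ) λ ν → IsPartition ν × size ν ≡ n × bead ν ≗ S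
  from-realisation (l , pl , size , l≗) = l , IsPartitionʳ⇒IsPartition l pl , size , λ y → trans (bead≗beads l y) (l≗ y)

  slideBeadUp : ∀ d ν → IsPartition ν → ∀ {x} → bead ν x ≡ true → bead ν (x + + suc d) ≡ false →
                Σ (List ℕ) λ μ → IsPartition μ × size μ ≡ size ν ℕ.+ suc d × bead μ ≗ mv (bead ν) x (x + + suc d)
  slideBeadUp d ν ν-partition bx by = from-realisation (slideUp d (realisation ν ν-partition) bx by)

  slideBeadDown : ∀ d ν → IsPartition ν → ∀ {x} → bead ν x ≡ true → bead ν (x - + suc d) ≡ false →
                  Σ (List ℕ) λ μ → IsPartition μ × bead μ ≗ mv (bead ν) x (x - + suc d)
  slideBeadDown d ν ν-partition bx by with realisation ν ν-partition
  ... | l₀ , pl₀ , _ , l₀≗ with slideDown d (l₀ , pl₀ , l₀≗) bx by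
  ...   | l , pl , l≗ = l , IsPartitionʳ⇒IsPartition l pl , λ y → trans (bead≗beads l y) (l≗ y)

  window : (ℤ → Bool) → ℤ → ℕ → ℕ
  window F x zero    = 0
  window F x (suc m) = bit (F (x - + suc m)) ℕ.+ window F x m

  legCount≡window : ∀ F m x → legCount F (suc m) x ≡ window F x m
  legCount≡window F m x = sum-upTo m
    where
    sum-upTo : ∀ m → sum (map (λ j → bit (F (x - + j))) (applyUpTo suc m)) ≡ window F x m
    sum-upTo zero    = refl
    sum-upTo (suc m) = begin
      sum (map g (applyUpTo suc (suc m)))          ≡⟨ cong (sum ∘ map g) (sym (LP.applyUpTo-∷ʳ suc m)) ⟩
      sum (map g (applyUpTo suc m ∷ʳ suc m))       ≡⟨ cong sum (LP.map-++ g (applyUpTo suc m) (suc m ∷ [])) ⟩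
      sum (map g (applyUpTo suc m) ++ g (suc m) ∷ []) ≡⟨ NLP.sum-++ (map g (applyUpTo suc m)) (g (suc m) ∷ []) ⟩
      sum (map g (applyUpTo suc m)) ℕ.+ (g (suc m) ℕ.+ 0) ≡⟨ cong₂ ℕ._+_ (sum-upTo m) (ℕP.+-identityʳ (g (suc m))) ⟩
      window F x m ℕ.+ g (suc m)                   ≡⟨ ℕP.+-comm (window F x m) (g (suc m)) ⟩
      window F x (suc m)                           ∎
      where
      open ≡-Reasoning
      g = λ j → bit (F (x - + j))

  window-cong : ∀ F G x m → (∀ j → 1 ℕ.≤ j → j ℕ.≤ m → F (x - + j) ≡ G (x - + j)) → window F x m ≡ window G x m
  window-cong F G x zero    _   = refl
  window-cong F G x (suc m) F≡G =
    cong₂ ℕ._+_ (cong bit (F≡G (suc m) (s≤s z≤n) ℕP.≤-refl))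
                (window-cong F G x m (λ j 1≤j j≤m → F≡G j 1≤j (ℕP.m≤n⇒m≤1+n j≤m)))

  window-suc : ∀ F G x m j₀ → 1 ℕ.≤ j₀ → j₀ ℕ.≤ m → F (x - + j₀) ≡ false → G (x - + j₀) ≡ true →
               (∀ j → 1 ℕ.≤ j → j ℕ.≤ m → j ≢ j₀ → F (x - + j) ≡ G (x - + j)) → window G x m ≡ suc (window F x m)
  window-suc F G x zero    (suc _) _ () _ _ _
  window-suc F G x (suc m) j₀ 1≤j₀ j₀≤1+m Fj₀ Gj₀ F≡G with ℕP.m≤n⇒m<n∨m≡n j₀≤1+m
  ... | inj₂ refl rewrite Fj₀ | Gj₀ =
    cong suc (sym (window-cong F G x m (λ j 1≤j j≤m → F≡G j 1≤j (ℕP.m≤n⇒m≤1+n j≤m) (ℕP.<⇒≢ (s≤s j≤m)))))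
  ... | inj₁ j₀≤m =
    trans (cong₂ ℕ._+_ (cong bit (sym (F≡G (suc m) (s≤s z≤n) ℕP.≤-refl (ℕP.>⇒≢ j₀≤m))))
                       (window-suc F G x m j₀ 1≤j₀ (ℕP.≤-pred j₀≤m) Fj₀ Gj₀
                                   (λ j 1≤j j≤m → F≡G j 1≤j (ℕP.m≤n⇒m≤1+n j≤m))))
          (ℕP.+-suc _ _)

  window-step : ∀ F w n → window F (w + + 1) (suc n) ≡ bit (F w) ℕ.+ window F w n
  window-step F w zero    = cong (λ v → bit (F v) ℕ.+ 0) (i+j-j≡i w (+ 1))
  window-step F w (suc n) =
    trans (cong₂ ℕ._+_ (cong (bit ∘ F) (by-ring w (+ n))) (window-step F w n))
          (x∙yz≈y∙xz (bit (F (w - + suc n))) (bit (F w)) (window F w n))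
    where
    by-ring : ∀ w n → w + + 1 - (+ 1 + (+ 1 + n)) ≡ w - (+ 1 + n)
    by-ring = solve-∀

  window-full : ∀ F x m → (∀ z → z < x → F z ≡ true) → window F x m ≡ m
  window-full F x zero    _      = refl
  window-full F x (suc m) F-full rewrite F-full (x - + suc m) (i-1+n<i x m) = cong suc (window-full F x m F-full)

  i-j-injective : ∀ x {i j} → x - + i ≡ x - + j → i ≡ j
  i-j-injective x {i} {j} e = ℤP.+-injective (ℤP.neg-injective (trans (sym (i+j-i≡j x (- + i))) (trans (cong (_- x) e) (i+j-i≡j x (- + j)))))

  i-j<i-k : ∀ x {j k} → k ℕ.< j → x - + j < x - + k
  i-j<i-k x k<j = ℤP.+-monoʳ-< x (ℤP.neg-mono-< (+<+ k<j))

  offset-in-window : ∀ x {m j} → 1 ℕ.≤ j → j ℕ.≤ m → x - + suc m < x - + j × x - + j < x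
  offset-in-window x 1≤j j≤m = i-j<i-k x (s≤s j≤m) , subst (x - + _ <_) (ℤP.+-identityʳ x) (i-j<i-k x 1≤j)

  i-j≤i-k : ∀ x {j k} → k ℕ.≤ j → x - + j ≤ x - + k
  i-j≤i-k x k≤j = ℤP.+-monoʳ-≤ x (ℤP.neg-mono-≤ (+≤+ k≤j))

  offset-of : ∀ {x z} m → x - + suc m < z → z < x → Σ ℕ λ j → 1 ℕ.≤ j × j ℕ.≤ m × x - + j ≡ z
  offset-of {x} {z} m lo z<x = suc n , s≤s z≤n , j≤m , x-j≡z
    where
    n = ℤ.∣ x - (z + + 1) ∣
    by-ring : ∀ x z → x - (+ 1 + (x - (z + + 1))) ≡ z
    by-ring = solve-∀
    x-j≡z : x - + suc n ≡ z
    x-j≡z = trans (cong (λ v → x - (+ 1 + v)) (ℤP.0≤i⇒+∣i∣≡i (ℤP.i≤j⇒0≤j-i (<⇒+1≤ z<x)))) (by-ring x z)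
    j≤m : suc n ℕ.≤ m
    j≤m = ℕP.≮⇒≥ λ m<j → ℤP.≤⇒≯ (subst (_≤ x - + suc m) x-j≡z (i-j≤i-k x m<j)) lo

  legCount-cong : ∀ F G m x → (∀ z → x - + suc m < z → z < x → F z ≡ G z) → legCount F (suc m) x ≡ legCount G (suc m) x
  legCount-cong F G m x F≡G = begin
    legCount F (suc m) x ≡⟨ legCount≡window F m x ⟩
    window F x m         ≡⟨ window-cong F G x m (λ j 1≤j j≤m → uncurry (F≡G (x - + j)) (offset-in-window x 1≤j j≤m)) ⟩
    window G x m         ≡⟨ legCount≡window G m x ⟨
    legCount G (suc m) x ∎
    where open ≡-Reasoning

  legCount-suc : ∀ F G m x z₀ → x - + suc m < z₀ → z₀ < x → F z₀ ≡ false → G z₀ ≡ true →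
                 (∀ z → x - + suc m < z → z < x → z ≢ z₀ → F z ≡ G z) → legCount G (suc m) x ≡ suc (legCount F (suc m) x)
  legCount-suc F G m x z₀ lo hi Fz₀ Gz₀ F≡G with offset-of m lo hi
  ... | j₀ , 1≤j₀ , j₀≤m , refl = begin
    legCount G (suc m) x       ≡⟨ legCount≡window G m x ⟩
    window G x m               ≡⟨ window-suc F G x m j₀ 1≤j₀ j₀≤m Fz₀ Gz₀ F≡G′ ⟩
    suc (window F x m)         ≡⟨ cong suc (legCount≡window F m x) ⟨
    suc (legCount F (suc m) x) ∎
    where
    open ≡-Reasoning
    F≡G′ : ∀ j → 1 ℕ.≤ j → j ℕ.≤ m → j ≢ j₀ → F (x - + j) ≡ G (x - + j)
    F≡G′ j 1≤j j≤m j≢j₀ = uncurry (F≡G (x - + j)) (offset-in-window x 1≤j j≤m) (j≢j₀ ∘ i-j-injective x)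

  legCount-mv-ends : ∀ F m x → legCount (mv F (x - + suc m) x) (suc m) x ≡ legCount F (suc m) x
  legCount-mv-ends F m x = legCount-cong _ F m x (λ z lo hi → mv-other F (<⇒≢ hi) (>⇒≢ lo))

  mv-mv-other : ∀ {T U S : ℤ → Bool} {x x′ y y′ z} → U ≗ mv T x x′ → S ≗ mv U y y′ →
                z ≢ x → z ≢ x′ → z ≢ y → z ≢ y′ → S z ≡ T z
  mv-mv-other {T} {U} {S} {x} {x′} {y} {y′} {z} U≗ S≗ z≢x z≢x′ z≢y z≢y′ =
    trans (S≗ z) (trans (mv-other U z≢y′ z≢y) (trans (U≗ z) (mv-other T z≢x′ z≢x)))

  removed-by : ∀ {T U S : ℤ → Bool} {x x′ y y′ z} → U ≗ mv T x x′ → S ≗ mv U y y′ →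
               T z ≡ true → S z ≡ false → z ≡ x ⊎ z ≡ y
  removed-by {T} {U} {S} {x} {x′} {y} {y′} {z} U≗ S≗ Tz Sz
    with ≡-or-≢ z y | ≡-or-≢ z y′ | ≡-or-≢ z x | ≡-or-≢ z x′
  ... | inj₁ z≡y | _         | _        | _         = inj₂ z≡y
  ... | inj₂ _   | inj₁ refl | _        | _         = ⊥-elim (true≢false (trans (sym (mv-to U y z)) (trans (sym (S≗ z)) Sz)))
  ... | inj₂ _   | inj₂ _    | inj₁ z≡x | _         = inj₁ z≡x
  ... | inj₂ z≢y | inj₂ z≢y′ | inj₂ _   | inj₁ refl =
    ⊥-elim (true≢false (trans (sym (mv-to T x z))
                       (trans (sym (U≗ z)) (trans (sym (mv-other U z≢y′ z≢y)) (trans (sym (S≗ z)) Sz)))))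
  ... | inj₂ z≢y | inj₂ z≢y′ | inj₂ z≢x | inj₂ z≢x′ =
    ⊥-elim (true≢false (trans (sym Tz) (trans (sym (mv-mv-other U≗ S≗ z≢x z≢x′ z≢y z≢y′)) Sz)))

  added-by : ∀ {T U S : ℤ → Bool} {x x′ y y′ z} → U ≗ mv T x x′ → S ≗ mv U y y′ → x ≢ x′ → y ≢ y′ →
             T z ≡ false → S z ≡ true → z ≡ x′ ⊎ z ≡ y′
  added-by {T} {U} {S} {x} {x′} {y} {y′} {z} U≗ S≗ x≢x′ y≢y′ Tz Sz
    with ≡-or-≢ z y′ | ≡-or-≢ z y | ≡-or-≢ z x′ | ≡-or-≢ z x
  ... | inj₁ z≡y′ | _         | _         | _         = inj₂ z≡y′
  ... | inj₂ _    | inj₁ refl | _         | _         = ⊥-elim (true≢false (trans (sym Sz) (trans (S≗ z) (mv-from U y≢y′))))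
  ... | inj₂ _    | inj₂ _    | inj₁ z≡x′ | _         = inj₁ z≡x′
  ... | inj₂ z≢y′ | inj₂ z≢y  | inj₂ _    | inj₁ refl =
    ⊥-elim (true≢false (trans (sym Sz) (trans (S≗ z) (trans (mv-other U z≢y′ z≢y) (trans (U≗ z) (mv-from T x≢x′))))))
  ... | inj₂ z≢y′ | inj₂ z≢y  | inj₂ z≢x′ | inj₂ z≢x  =
    ⊥-elim (true≢false (trans (sym Sz) (trans (mv-mv-other U≗ S≗ z≢x z≢x′ z≢y z≢y′) Tz)))

  %ℕ-≡⇒≡+*ℕ : ∀ u v n .{{_ : ℕ.NonZero n}} → u ℤ.%ℕ n ≡ v ℤ.%ℕ n → v ≡ u + (v ℤ./ℕ n - u ℤ./ℕ n) ℤ.* + n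
  %ℕ-≡⇒≡+*ℕ u v n u%n≡v%n = begin
    v                               ≡⟨ a≡a%ℕn+[a/ℕn]*n v n ⟩
    + (v ℤ.%ℕ n) + v/n ℤ.* + n      ≡⟨ cong (λ r → + r + v/n ℤ.* + n) (sym u%n≡v%n) ⟩
    + (u ℤ.%ℕ n) + v/n ℤ.* + n      ≡⟨ by-ring (+ (u ℤ.%ℕ n)) u/n v/n (+ n) ⟨
    + (u ℤ.%ℕ n) + u/n ℤ.* + n + (v/n - u/n) ℤ.* + n ≡⟨ cong (_+ (v/n - u/n) ℤ.* + n) (a≡a%ℕn+[a/ℕn]*n u n) ⟨
    u + (v/n - u/n) ℤ.* + n         ∎
    where
    open ≡-Reasoning
    u/n = u ℤ./ℕ n
    v/n = v ℤ./ℕ n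
    by-ring : ∀ r a b n → r + a ℤ.* n + (b - a) ℤ.* n ≡ r + b ℤ.* n
    by-ring = solve-∀

  module Core {q : ℕ} {γ : List ℕ} (γ-partition : IsPartition γ) (γ-core : IsCore (suc (suc q)) γ)
              {ρ : ℕ → ℤ} (ρ-spec : IsRho (suc (suc q)) γ ρ) where

    p : ℕ
    p = suc (suc q)

    S : ℤ → Bool
    S = bead γ

    bead-below : ∀ y → S y ≡ true → S (y - + p) ≡ true
    bead-below y Sy with S (y - + p) in Sy-p
    ... | true  = refl
    ... | false with slideBeadDown (suc q) γ γ-partition Sy Sy-p
    ...   | μ , μ-partition , μ≗ = ⊥-elim (γ-core μ _ (μ-partition , y , Sy , Sy-p , μ≗ , refl))

    gap-above : ∀ w → S w ≡ false → S (w + + p) ≡ false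
    gap-above w Sw = ¬-not λ Sw+p → true≢false (trans (sym (bead-below (w + + p) Sw+p)) (trans (cong S (i+j-j≡i w (+ p))) Sw))

    gaps-above : ∀ m w → S w ≡ false → S (w + + (m ℕ.* p)) ≡ false
    gaps-above zero    w Sw = trans (cong S (ℤP.+-identityʳ w)) Sw
    gaps-above (suc m) w Sw = trans (cong S (sym (ℤP.+-assoc w (+ p) (+ (m ℕ.* p))))) (gaps-above m (w + + p) (gap-above w Sw))

    beads-far-below : ∀ y → y < - (+ length γ) → S y ≡ true
    beads-far-below y y<-ℓ = cong (_∨ any (λ i → y =ᶻ (+ part γ i - + i)) (applyUpTo suc (length γ))) (<⇒<ᶻ y<-ℓ)

    ρ-bead : ∀ {c} → c ℕ.< p → S (ρ c) ≡ true
    ρ-bead c<p = proj₁ (proj₁ ρ-spec _ c<p)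

    ρ-top : ∀ {c} → c ℕ.< p → ∀ m → S (ρ c + + (suc m ℕ.* p)) ≡ false
    ρ-top c<p = proj₂ (proj₁ ρ-spec _ c<p)

    ρ+p-gap : ∀ {c} → c ℕ.< p → S (ρ c + + p) ≡ false
    ρ+p-gap {c} c<p = subst (λ k → S (ρ c + + k) ≡ false) (ℕP.+-identityʳ p) (ρ-top c<p 0)

    ρ+2p-gap : ∀ {c} → c ℕ.< p → S (ρ c + + p + + p) ≡ false
    ρ+2p-gap {c} c<p = trans (cong S (ℤP.+-assoc (ρ c) (+ p) (+ p)))
                             (subst (λ k → S (ρ c + + (p ℕ.+ k)) ≡ false) (ℕP.+-identityʳ p) (ρ-top c<p 1))

    ρ-< : ∀ {r s} → r ℕ.< s → s ℕ.< p → ρ r < ρ s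
    ρ-< = proj₂ ρ-spec _ _

    ρ-≤ : ∀ {r s} → r ℕ.≤ s → s ℕ.< p → ρ r ≤ ρ s
    ρ-≤ r≤s s<p with ℕP.m≤n⇒m<n∨m≡n r≤s
    ... | inj₁ r<s  = ℤP.<⇒≤ (ρ-< r<s s<p)
    ... | inj₂ refl = ℤP.≤-refl

    ρ-injective : ∀ {r s} → r ℕ.< p → s ℕ.< p → ρ r ≡ ρ s → r ≡ s
    ρ-injective {r} {s} r<p s<p ρr≡ρs with ℕP.<-cmp r s
    ... | tri< r<s _ _ = ⊥-elim (<⇒≢ (ρ-< r<s s<p) ρr≡ρs)
    ... | tri≈ _ r≡s _ = r≡s
    ... | tri> _ _ s<r = ⊥-elim (>⇒≢ (ρ-< s<r r<p) ρr≡ρs)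

    IsTop : ℤ → Set
    IsTop u = S u ≡ true × (∀ m → S (u + + (suc m ℕ.* p)) ≡ false)

    ρ-isTop : ∀ {c} → c ℕ.< p → IsTop (ρ c)
    ρ-isTop c<p = ρ-bead c<p , ρ-top c<p

    no-bead-above-top : ∀ {u v} → IsTop u → S v ≡ true → u < v → ∀ D → v ≢ u + D ℤ.* + p
    no-bead-above-top {u} _        _  u<v (+ zero)   v≡u   = <⇒≢ u<v (sym (trans v≡u (ℤP.+-identityʳ u)))
    no-bead-above-top {u} (_ , gaps) Sv _  (+ suc m) v≡u+Dp =
      true≢false (trans (sym Sv) (trans (cong S (trans v≡u+Dp (cong (λ d → u + d) (sym (ℤP.pos-* (suc m) p))))) (gaps m)))
    no-bead-above-top {u} _        _  u<v -[1+ m ]   v≡u+Dp = ℤP.<-asym u<v (subst (_< u) (sym v≡u+Dp) (i-1+n<i u _))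

    runner : ℤ → Fin p
    runner u = fromℕ< (n%ℕd<d u p)

    runner-≡ : ∀ {u v} → runner u ≡ runner v → u ℤ.%ℕ p ≡ v ℤ.%ℕ p
    runner-≡ {u} {v} e = trans (sym (FinP.toℕ-fromℕ< (n%ℕd<d u p))) (trans (cong toℕ e) (FinP.toℕ-fromℕ< (n%ℕd<d v p)))

    top-runner-injective : ∀ {u v} → IsTop u → IsTop v → runner u ≡ runner v → u ≡ v
    top-runner-injective {u} {v} top-u top-v same-runner with ℤP.<-cmp u v
    ... | tri< u<v _ _ = ⊥-elim (no-bead-above-top top-u (proj₁ top-v) u<v (v ℤ./ℕ p - u ℤ./ℕ p)
                                   (%ℕ-≡⇒≡+*ℕ u v p (runner-≡ {u} {v} same-runner)))
    ... | tri≈ _ u≡v _ = u≡v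
    ... | tri> _ _ v<u = ⊥-elim (no-bead-above-top top-v (proj₁ top-u) v<u (u ℤ./ℕ p - v ℤ./ℕ p)
                                   (%ℕ-≡⇒≡+*ℕ v u p (runner-≡ {v} {u} (sym same-runner))))

    top-is-ρ : ∀ {z} → S z ≡ true → S (z + + p) ≡ false → Σ ℕ λ c → c ℕ.< p × ρ c ≡ z
    top-is-ρ {z} Sz Sz+p with FinP.pigeonhole (ℕP.n<1+n p) (λ { Fin.zero → runner z ; (Fin.suc i) → runner (ρ (toℕ i)) })
    ... | Fin.zero  , Fin.zero  , ()  , _
    ... | Fin.suc _ , Fin.zero  , ()  , _
    ... | Fin.zero  , Fin.suc j , _   , same-runner =
      toℕ j , FinP.toℕ<n j , sym (top-runner-injective top-z (ρ-isTop (FinP.toℕ<n j)) same-runner)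
      where
      top-z : IsTop z
      top-z = Sz , λ m → trans (cong S (sym (ℤP.+-assoc z (+ p) (+ (m ℕ.* p))))) (gaps-above m (z + + p) Sz+p)
    ... | Fin.suc i , Fin.suc j , i<j , same-runner =
      ⊥-elim (ℕP.<⇒≢ (ℕP.≤-pred i<j) (ρ-injective (FinP.toℕ<n i) (FinP.toℕ<n j)
               (top-runner-injective (ρ-isTop (FinP.toℕ<n i)) (ρ-isTop (FinP.toℕ<n j)) same-runner)))

    #above : ℤ → ℕ
    #above t = count (λ c → t <ᶻ ρ c) p

    #ρ-at : ℤ → ℕ
    #ρ-at z = count (λ c → ρ c =ᶻ z) p

    #ρ-at-gap : ∀ z → S z ≡ false → #ρ-at z ≡ 0
    #ρ-at-gap z Sz = count-none p (λ c → ρ c =ᶻ z) λ c c<p → ≢⇒=ᶻ {ρ c} {z} λ ρc≡z →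
                       true≢false (trans (sym (ρ-bead {c} c<p)) (trans (cong S ρc≡z) Sz))

    runner-step : ∀ z → bit (S z) ≡ bit (S (z + + p)) ℕ.+ #ρ-at z
    runner-step z with S z in Sz | S (z + + p) in Sz+p
    ... | true  | true  = cong suc (sym (count-none p (λ c → ρ c =ᶻ z) λ c c<p → ≢⇒=ᶻ {ρ c} {z} λ ρc≡z →
                            true≢false (trans (sym Sz+p) (trans (cong (λ w → S (w + + p)) (sym ρc≡z)) (ρ+p-gap {c} c<p)))))
    ... | true  | false with top-is-ρ Sz Sz+p
    ...   | c₀ , c₀<p , ρc₀≡z = sym (count-one p (λ c → ρ c =ᶻ z) c₀<p (≡⇒=ᶻ ρc₀≡z)
                                    λ c c<p ρc=z → ρ-injective c<p c₀<p (trans (=ᶻ⇒≡ ρc=z) (sym ρc₀≡z)))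
    runner-step z | false | true  = ⊥-elim (true≢false (trans (sym (bead-below (z + + p) Sz+p)) (trans (cong S (i+j-j≡i z (+ p))) Sz)))
    runner-step z | false | false = sym (#ρ-at-gap z Sz)

    #above-step : ∀ t → #above t ≡ #above (t + + 1) ℕ.+ #ρ-at (t + + 1)
    #above-step t = count-+ p _ _ (λ c → ρ c =ᶻ (t + + 1)) (λ c → split (ρ c))
      where
      split : ∀ r → bit (t <ᶻ r) ≡ bit ((t + + 1) <ᶻ r) ℕ.+ bit (r =ᶻ (t + + 1))
      split r with ℤP.<-cmp r (t + + 1)
      ... | tri< r<t+1 _ _ rewrite ≮⇒<ᶻ {t} {r} (ℤP.<⇒≱ r<t+1 ∘ <⇒+1≤) | ≮⇒<ᶻ (ℤP.<-asym r<t+1) | ≢⇒=ᶻ (<⇒≢ r<t+1) = refl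
      ... | tri≈ _ r≡t+1 _ rewrite <⇒<ᶻ (subst (t <_) (sym r≡t+1) (i<i+1 t)) | ≮⇒<ᶻ (ℤP.<-irrefl (sym r≡t+1)) | ≡⇒=ᶻ r≡t+1 = refl
      ... | tri> _ _ t+1<r rewrite <⇒<ᶻ (ℤP.<-trans (i<i+1 t) t+1<r) | <⇒<ᶻ t+1<r | ≢⇒=ᶻ (>⇒≢ t+1<r) = refl

    beadsIn : ℤ → ℕ
    beadsIn w = window S w (suc q) ℕ.+ bit (S w)

    beadsIn-far-below : ∀ w → w < - (+ length γ) → beadsIn w ≡ #above (w - + p)
    beadsIn-far-below w w<-ℓ = begin
      window S w (suc q) ℕ.+ bit (S w) ≡⟨ cong₂ ℕ._+_ (window-full S w (suc q) λ z z<w → beads-far-below z (ℤP.<-trans z<w w<-ℓ))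
                                                      (cong bit (beads-far-below w w<-ℓ)) ⟩
      suc q ℕ.+ 1                     ≡⟨ ℕP.+-comm (suc q) 1 ⟩
      p ∸ 0                           ≡⟨ count-upper p 0 (λ c → (w - + p) <ᶻ ρ c) (λ _ _ ()) (λ c c<p _ → <⇒<ᶻ (w-p<ρ c<p)) ⟨
      #above (w - + p)                ∎
      where
      open ≡-Reasoning
      w-p<ρ : ∀ {c} → c ℕ.< p → w - + p < ρ c
      w-p<ρ {c} c<p = +-cancelʳ-< (+ p) (subst (_< ρ c + + p) (sym (i-j+j≡i w (+ p)))
                        (ℤP.<-≤-trans w<-ℓ (ℤP.≮⇒≥ λ lo →
                          true≢false (trans (sym (beads-far-below (ρ c + + p) lo)) (ρ+p-gap {c} c<p)))))

    beadsIn-step : ∀ w → beadsIn w ≡ #above (w - + p) → beadsIn (w + + 1) ≡ #above (w + + 1 - + p)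
    beadsIn-step w IH = ℕP.+-cancelʳ-≡ (#ρ-at z) (beadsIn (w + + 1)) (#above (w + + 1 - + p)) (trans bead-count (trans IH runner-count))
      where
      open ≡-Reasoning
      z = w - + suc q
      z+p≡w+1 : z + + p ≡ w + + 1
      z+p≡w+1 = by-ring w (+ q)
        where
        by-ring : ∀ w Q → w - (+ 1 + Q) + (+ 1 + (+ 1 + Q)) ≡ w + + 1
        by-ring = solve-∀
      w-p+1≡w+1-p : w - + p + + 1 ≡ w + + 1 - + p
      w-p+1≡w+1-p = by-ring w (+ q)
        where
        by-ring : ∀ w Q → w - (+ 1 + (+ 1 + Q)) + + 1 ≡ w + + 1 - (+ 1 + (+ 1 + Q))
        by-ring = solve-∀
      w-p+1≡z : w - + p + + 1 ≡ z
      w-p+1≡z = by-ring w (+ q)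
        where
        by-ring : ∀ w Q → w - (+ 1 + (+ 1 + Q)) + + 1 ≡ w - (+ 1 + Q)
        by-ring = solve-∀
      rearrange : ∀ a W c N → a ℕ.+ W ℕ.+ c ℕ.+ N ≡ c ℕ.+ N ℕ.+ W ℕ.+ a
      rearrange = NS.solve-∀
      bead-count : beadsIn (w + + 1) ℕ.+ #ρ-at z ≡ beadsIn w
      bead-count = begin
        window S (w + + 1) (suc q) ℕ.+ bit (S (w + + 1)) ℕ.+ #ρ-at z
          ≡⟨ cong (λ v → v ℕ.+ bit (S (w + + 1)) ℕ.+ #ρ-at z) (window-step S w q) ⟩
        bit (S w) ℕ.+ window S w q ℕ.+ bit (S (w + + 1)) ℕ.+ #ρ-at z
          ≡⟨ rearrange (bit (S w)) (window S w q) (bit (S (w + + 1))) (#ρ-at z) ⟩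
        bit (S (w + + 1)) ℕ.+ #ρ-at z ℕ.+ window S w q ℕ.+ bit (S w)
          ≡⟨ cong (λ v → v ℕ.+ window S w q ℕ.+ bit (S w))
                  (trans (cong (λ v → bit (S v) ℕ.+ #ρ-at z) (sym z+p≡w+1)) (sym (runner-step z))) ⟩
        bit (S z) ℕ.+ window S w q ℕ.+ bit (S w)
          ∎
      runner-count : #above (w - + p) ≡ #above (w + + 1 - + p) ℕ.+ #ρ-at z
      runner-count = trans (#above-step (w - + p)) (cong₂ ℕ._+_ (cong #above w-p+1≡w+1-p) (cong #ρ-at w-p+1≡z))

    beadsIn≡#above : ∀ w → beadsIn w ≡ #above (w - + p)
    beadsIn≡#above w with <⊎≥ w (- (+ length γ))
    ... | inj₁ w<-ℓ = beadsIn-far-below w w<-ℓ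
    ... | inj₂ -ℓ≤w = subst (λ v → beadsIn v ≡ #above (v - + p)) w₀+n≡w (from-w₀ n)
      where
      w₀ = - (+ length γ) - + 1
      n = ℤ.∣ w - w₀ ∣
      w₀+n≡w : w₀ + + n ≡ w
      w₀+n≡w = trans (cong (λ d → w₀ + d) (ℤP.0≤i⇒+∣i∣≡i (ℤP.i≤j⇒0≤j-i (ℤP.<⇒≤ (ℤP.<-≤-trans (i-1<i _) -ℓ≤w)))))
                     (i+[j-i]≡j w₀ w)
      from-w₀ : ∀ m → beadsIn (w₀ + + m) ≡ #above (w₀ + + m - + p)
      from-w₀ zero    = beadsIn-far-below _ (subst (_< - (+ length γ)) (sym (ℤP.+-identityʳ w₀)) (i-1<i _))
      from-w₀ (suc m) = subst (λ v → beadsIn v ≡ #above (v - + p))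
                              (trans (ℤP.+-assoc w₀ (+ m) (+ 1)) (cong (λ d → w₀ + d) (ℤP.+-comm (+ m) (+ 1))))
                              (beadsIn-step (w₀ + + m) (from-w₀ m))

    legCount+bit≡#above : ∀ w → legCount S p w ℕ.+ bit (S w) ≡ #above (w - + p)
    legCount+bit≡#above w = trans (cong (ℕ._+ bit (S w)) (legCount≡window S (suc q) w)) (beadsIn≡#above w)

    #above-between : ∀ m t → m ℕ.< p → ρ m ≤ t → (suc m ℕ.< p → t < ρ (suc m)) → #above t ≡ p ∸ suc m
    #above-between m t m<p ρm≤t t<ρ[1+m] = count-upper p (suc m) (λ c → t <ᶻ ρ c) below above
      where
      below : ∀ c → c ℕ.< p → c ℕ.< suc m → (t <ᶻ ρ c) ≡ false
      below c _ c<1+m = ≮⇒<ᶻ (ℤP.≤⇒≯ (ℤP.≤-trans (ρ-≤ (ℕP.≤-pred c<1+m) m<p) ρm≤t))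
      above : ∀ c → c ℕ.< p → suc m ℕ.≤ c → (t <ᶻ ρ c) ≡ true
      above c c<p m<c = <⇒<ᶻ (ℤP.<-≤-trans (t<ρ[1+m] (ℕP.≤-<-trans m<c c<p)) (ρ-≤ m<c c<p))

    legCount-gap : ∀ m w → S w ≡ false → m ℕ.< p → ρ m ≤ w - + p → (suc m ℕ.< p → w - + p < ρ (suc m)) →
                   legCount S p w ≡ p ∸ suc m
    legCount-gap m w Sw m<p lo hi = begin
      legCount S p w                   ≡⟨ ℕP.+-identityʳ _ ⟨
      legCount S p w ℕ.+ 0             ≡⟨ cong (λ b → legCount S p w ℕ.+ bit b) Sw ⟨
      legCount S p w ℕ.+ bit (S w)     ≡⟨ legCount+bit≡#above w ⟩
      #above (w - + p)                 ≡⟨ #above-between m (w - + p) m<p lo hi ⟩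
      p ∸ suc m                        ∎
      where open ≡-Reasoning

    legCount-bead : ∀ m w → S w ≡ true → m ℕ.< p → ρ m ≤ w - + p → (suc m ℕ.< p → w - + p < ρ (suc m)) →
                    legCount S p w ℕ.+ 1 ≡ p ∸ suc m
    legCount-bead m w Sw m<p lo hi = begin
      legCount S p w ℕ.+ 1             ≡⟨ cong (λ b → legCount S p w ℕ.+ bit b) Sw ⟨
      legCount S p w ℕ.+ bit (S w)     ≡⟨ legCount+bit≡#above w ⟩
      #above (w - + p)                 ≡⟨ #above-between m (w - + p) m<p lo hi ⟩
      p ∸ suc m                        ∎
      where open ≡-Reasoning

    legCount-ρ+p : ∀ {b} → b ℕ.< p → legCount S p (ρ b + + p) ≡ p ∸ suc b
    legCount-ρ+p {b} b<p = legCount-gap b (ρ b + + p) (ρ+p-gap b<p) b<p (ℤP.≤-reflexive (sym ρb+p-p≡ρb))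
                                       (λ 1+b<p → subst (_< ρ (suc b)) (sym ρb+p-p≡ρb) (ρ-< (ℕP.n<1+n b) 1+b<p))
      where
      ρb+p-p≡ρb = i+j-j≡i (ρ b) (+ p)

    open Labels p ρ using (pyr; labelBeads; ceil; h; g; δaux; δ)

    pyr-ρ : ∀ {a b} → a ℕ.≤ b → b ℕ.< p → pyr a b ≡ ((ρ b - ρ a) <ᶻ (+ p))
    pyr-ρ {a} {b} a≤b b<p rewrite dec-false (suc b ℕ.≤? a) (ℕP.<⇒≱ (s≤s a≤b)) | dec-false (p ℕ.≤? b) (ℕP.<⇒≱ b<p) = refl

    pyr-true⇒ : ∀ {a b} → a ℕ.≤ b → b ℕ.< p → pyr a b ≡ true → ρ b < ρ a + + p
    pyr-true⇒ {a} {b} a≤b b<p pyr≡true =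
      subst₂ _<_ (i-j+j≡i (ρ b) (ρ a)) (ℤP.+-comm (+ p) (ρ a))
             (ℤP.+-monoˡ-< (ρ a) (<ᶻ⇒< {ρ b - ρ a} (trans (sym (pyr-ρ a≤b b<p)) pyr≡true)))

    pyr-false⇒ : ∀ {a b} → a ℕ.≤ b → b ℕ.< p → pyr a b ≡ false → ρ a + + p < ρ b
    pyr-false⇒ {a} {b} a≤b b<p pyr≡false = ℤP.≤∧≢⇒< ρa+p≤ρb ρa+p≢ρb
      where
      ρa+p≤ρb : ρ a + + p ≤ ρ b
      ρa+p≤ρb = subst₂ _≤_ (ℤP.+-comm (+ p) (ρ a)) (i-j+j≡i (ρ b) (ρ a))
                       (ℤP.+-monoˡ-≤ (ρ a) (ℤP.≮⇒≥ (<ᶻ⇒≮ {ρ b - ρ a} (trans (sym (pyr-ρ a≤b b<p)) pyr≡false))))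
      ρa+p≢ρb : ρ a + + p ≢ ρ b
      ρa+p≢ρb e = true≢false (trans (sym (ρ-bead b<p)) (trans (cong S (sym e)) (ρ+p-gap (ℕP.≤-<-trans a≤b b<p))))

    pyr-true : ∀ {a b} → a ℕ.≤ b → b ℕ.< p → ρ b < ρ a + + p → pyr a b ≡ true
    pyr-true {a} {b} a≤b b<p ρb<ρa+p =
      trans (pyr-ρ a≤b b<p) (<⇒<ᶻ (subst (ρ b - ρ a <_) (i+j-i≡j (ρ a) (+ p)) (ℤP.+-monoˡ-< (- ρ a) ρb<ρa+p)))

    pyr-beyond : ∀ {a b} → a ℕ.≤ b → p ℕ.≤ b → pyr a b ≡ false
    pyr-beyond {a} {b} a≤b p≤b rewrite dec-false (suc b ℕ.≤? a) (ℕP.<⇒≱ (s≤s a≤b)) | dec-true (p ℕ.≤? b) p≤b = refl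

    pyr-inner : ∀ {a′ a b b′} → a′ ℕ.≤ a → a ℕ.≤ b → b ℕ.≤ b′ → b′ ℕ.< p → pyr a′ b′ ≡ true → pyr a b ≡ true
    pyr-inner {a′} {a} {b} {b′} a′≤a a≤b b≤b′ b′<p outer = pyr-true a≤b b<p (begin-strict
      ρ b           ≤⟨ ρ-≤ b≤b′ b′<p ⟩
      ρ b′          <⟨ pyr-true⇒ (ℕP.≤-trans a′≤a (ℕP.≤-trans a≤b b≤b′)) b′<p outer ⟩
      ρ a′ + + p    ≤⟨ ℤP.+-monoˡ-≤ (+ p) (ρ-≤ a′≤a (ℕP.≤-<-trans a≤b b<p)) ⟩
      ρ a + + p     ∎)
      where
      open ℤP.≤-Reasoning
      b<p = ℕP.≤-<-trans b≤b′ b′<p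

    hook-added : ∀ μ ν {f} → IsPartition μ → bead ν ≗ mv (bead μ) f (f + + p) → bead μ f ≡ true → bead μ (f + + p) ≡ false →
                 RemoveHook p ν μ (legCount (bead ν) p (f + + p))
    hook-added μ ν {f} μ-partition ν≗ μf μf+p = μ-partition , f + + p , νf+p , νf , μ≗ , refl
      where
      f≢f+p = <⇒≢ (i<i+1+n f (suc q))
      f+p-p≡f = i+j-j≡i f (+ p)
      νf+p : bead ν (f + + p) ≡ true
      νf+p = trans (ν≗ (f + + p)) (mv-to (bead μ) f (f + + p))
      νf : bead ν (f + + p - + p) ≡ false
      νf = trans (cong (bead ν) f+p-p≡f) (trans (ν≗ f) (mv-from (bead μ) f≢f+p))
      μ≗ : bead μ ≗ mv (bead ν) (f + + p) (f + + p - + p)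
      μ≗ y = trans (sym (mv-undo (bead μ) μf μf+p f≢f+p y))
                   (sym (trans (cong (λ t → mv (bead ν) (f + + p) t y) f+p-p≡f) (mv-cong (f + + p) f ν≗ y)))

    infix 4 _∈∂_
    _∈∂_ : Label → ℕ → Set
    L ∈∂ l = LabelIn p ρ γ (size γ ℕ.+ 2 ℕ.* p) L l

    -- The second leg is measured in γ itself: the intermediate abacus is γ with the bead at
    -- y - p moved to y, and the window of y does not see that change.
    HookLegs : (ℤ → Bool) → ℕ → Set
    HookLegs T v = ∀ {x y} → T x ≡ true → T (x - + p) ≡ false → S ≗ mv (mv T x (x - + p)) y (y - + p) →
                   ∣ legCount T p x - legCount S p y ∣ ≡ v

    ∈∂-intro : ∀ L v {u w} → S u ≡ true → S (u + + p) ≡ false →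
               mv S u (u + + p) w ≡ true → mv S u (u + + p) (w + + p) ≡ false →
               labelBeads S L ≗ mv (mv S u (u + + p)) w (w + + p) → HookLegs (labelBeads S L) v →
               L ∈∂ v
    ∈∂-intro L v {u} {w} Su Su+p S₁w S₁w+p L≗ legs with slideBeadUp (suc q) γ γ-partition {u} Su Su+p
    ... | γ₁ , γ₁-partition , size₁ , γ₁≗ with trans (γ₁≗ w) S₁w | trans (γ₁≗ (w + + p)) S₁w+p
    ...   | γ₁w | γ₁w+p with slideBeadUp (suc q) γ₁ γ₁-partition {w} γ₁w γ₁w+p
    ...     | ν , ν-partition , size₂ , ν≗ =
      ν , ν-partition , size-ν , ν≗L ,
      (γ₁ , _ , _ , hook-added γ₁ ν γ₁-partition ν≗ γ₁w γ₁w+p , hook-added γ γ₁ γ-partition γ₁≗ Su Su+p) , unique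
      where
      size-ν : size ν ≡ size γ ℕ.+ 2 ℕ.* p
      size-ν = trans size₂ (trans (cong (ℕ._+ p) size₁) (by-ring (size γ) p))
        where
        by-ring : ∀ s p → s ℕ.+ p ℕ.+ p ≡ s ℕ.+ 2 ℕ.* p
        by-ring = NS.solve-∀
      ν≗L : bead ν ≗ labelBeads S L
      ν≗L y = trans (ν≗ y) (trans (mv-cong w (w + + p) γ₁≗ y) (sym (L≗ y)))
      unique : ∀ μ l₁ l₂ → RemoveHook p ν μ l₁ → RemoveHook p μ γ l₂ → ∣ l₁ - l₂ ∣ ≡ v
      unique μ _ _ (_ , x , νx , νx-p , μ≗ , refl) (_ , y , μy , μy-p , γ≗ , refl) = begin
        ∣ legCount (bead ν) p x - legCount (bead μ) p y ∣ ≡⟨ cong₂ ∣_-_∣ (legCount-cong (bead ν) T (suc q) x (λ z _ _ → ν≗L z)) μ-leg ⟩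
        ∣ legCount T p x - legCount S p y ∣                ≡⟨ legs (trans (sym (ν≗L x)) νx) (trans (sym (ν≗L (x - + p))) νx-p) S≗ ⟩
        v                                                  ∎
        where
        open ≡-Reasoning
        T = labelBeads S L
        μ≗S : bead μ ≗ mv S (y - + p) y
        μ≗S z = trans (sym (mv-undo (bead μ) μy μy-p (>⇒≢ (i-1+n<i y (suc q))) z)) (sym (mv-cong (y - + p) y γ≗ z))
        μ-leg : legCount (bead μ) p y ≡ legCount S p y
        μ-leg = trans (legCount-cong (bead μ) (mv S (y - + p) y) (suc q) y (λ z _ _ → μ≗S z)) (legCount-mv-ends S (suc q) y)
        S≗ : S ≗ mv (mv T x (x - + p)) y (y - + p)
        S≗ z = trans (γ≗ z) (mv-cong y (y - + p) (λ z′ → trans (μ≗ z′) (mv-cong x (x - + p) ν≗L z′)) z)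

    module Pair {a b} (a<b : a ℕ.< b) (b<p : b ℕ.< p) where

      a<p = ℕP.<-trans a<b b<p
      ρa<ρb = ρ-< a<b b<p
      ρa+p<ρb+p = ℤP.+-monoˡ-< (+ p) ρa<ρb

      S₁ T : ℤ → Bool
      S₁ = mv S (ρ a) (ρ a + + p)
      T = mv S₁ (ρ b) (ρ b + + p)

      T-other : ∀ {z} → z ≢ ρ a → z ≢ ρ a + + p → z ≢ ρ b → z ≢ ρ b + + p → T z ≡ S z
      T-other z≢ρa z≢ρa+p z≢ρb z≢ρb+p = trans (mv-other S₁ z≢ρb+p z≢ρb) (mv-other S z≢ρa+p z≢ρa)

      T-ρa+p : T (ρ a + + p) ≡ true
      T-ρa+p = trans (mv-other S₁ (<⇒≢ ρa+p<ρb+p) ρa+p≢ρb) (mv-to S (ρ a) (ρ a + + p))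
        where
        ρa+p≢ρb : ρ a + + p ≢ ρ b
        ρa+p≢ρb e = true≢false (trans (sym (ρ-bead b<p)) (trans (cong S (sym e)) (ρ+p-gap a<p)))

      T-ρb+p : T (ρ b + + p) ≡ true
      T-ρb+p = mv-to S₁ (ρ b) (ρ b + + p)

      T-ρb : T (ρ b) ≡ false
      T-ρb = mv-from S₁ (<⇒≢ (i<i+1+n (ρ b) (suc q)))

      window-ρb+p : ∀ {z} → ρ b + + p - + p < z → ρ b < z
      window-ρb+p = subst (_< _) (i+j-j≡i (ρ b) (+ p))

      window-ρa+p : ∀ {z} → ρ a + + p - + p < z → ρ a < z
      window-ρa+p = subst (_< _) (i+j-j≡i (ρ a) (+ p))

      leg-ρb+p : legCount T p (ρ b + + p) ≡ (p ∸ suc b) ℕ.+ bit (pyr a b)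
      leg-ρb+p with pyr a b in close
      ... | true  = begin
        legCount T p (ρ b + + p)       ≡⟨ legCount-suc S T (suc q) (ρ b + + p) (ρ a + + p) lo ρa+p<ρb+p (ρ+p-gap a<p) T-ρa+p agree ⟩
        suc (legCount S p (ρ b + + p)) ≡⟨ cong suc (legCount-ρ+p b<p) ⟩
        suc (p ∸ suc b)                ≡⟨ ℕP.+-comm 1 _ ⟩
        (p ∸ suc b) ℕ.+ 1              ∎
        where
        open ≡-Reasoning
        lo = subst (_< ρ a + + p) (sym (i+j-j≡i (ρ b) (+ p))) (pyr-true⇒ (ℕP.<⇒≤ a<b) b<p close)
        agree : ∀ z → ρ b + + p - + p < z → z < ρ b + + p → z ≢ ρ a + + p → S z ≡ T z
        agree z lo hi z≢ρa+p = sym (T-other (>⇒≢ (ℤP.<-trans ρa<ρb (window-ρb+p lo))) z≢ρa+p (>⇒≢ (window-ρb+p lo)) (<⇒≢ hi))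
      ... | false = trans (legCount-cong T S (suc q) (ρ b + + p) agree) (trans (legCount-ρ+p b<p) (sym (ℕP.+-identityʳ _)))
        where
        far = pyr-false⇒ (ℕP.<⇒≤ a<b) b<p close
        agree : ∀ z → ρ b + + p - + p < z → z < ρ b + + p → T z ≡ S z
        agree z lo hi = T-other (>⇒≢ (ℤP.<-trans ρa<ρb (window-ρb+p lo))) (>⇒≢ (ℤP.<-trans far (window-ρb+p lo)))
                                (>⇒≢ (window-ρb+p lo)) (<⇒≢ hi)

      leg-ρa+p : legCount T p (ρ a + + p) ℕ.+ bit (pyr a b) ≡ p ∸ suc a
      leg-ρa+p with pyr a b in close
      ... | true  = begin
        legCount T p (ρ a + + p) ℕ.+ 1 ≡⟨ ℕP.+-comm _ 1 ⟩
        suc (legCount T p (ρ a + + p)) ≡⟨ legCount-suc T S (suc q) (ρ a + + p) (ρ b) lo hi T-ρb (ρ-bead b<p) agree ⟨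
        legCount S p (ρ a + + p)       ≡⟨ legCount-ρ+p a<p ⟩
        p ∸ suc a                      ∎
        where
        open ≡-Reasoning
        lo = subst (_< ρ b) (sym (i+j-j≡i (ρ a) (+ p))) ρa<ρb
        hi = pyr-true⇒ (ℕP.<⇒≤ a<b) b<p close
        agree : ∀ z → ρ a + + p - + p < z → z < ρ a + + p → z ≢ ρ b → T z ≡ S z
        agree z lo hi z≢ρb = T-other (>⇒≢ (window-ρa+p lo)) (<⇒≢ hi) z≢ρb (<⇒≢ (ℤP.<-trans hi ρa+p<ρb+p))
      ... | false = trans (ℕP.+-identityʳ _) (trans (legCount-cong T S (suc q) (ρ a + + p) agree) (legCount-ρ+p a<p))
        where
        far = pyr-false⇒ (ℕP.<⇒≤ a<b) b<p close
        agree : ∀ z → ρ a + + p - + p < z → z < ρ a + + p → T z ≡ S z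
        agree z lo hi = T-other (>⇒≢ (window-ρa+p lo)) (<⇒≢ hi) (<⇒≢ (ℤP.<-trans hi far)) (<⇒≢ (ℤP.<-trans hi ρa+p<ρb+p))

      legs : HookLegs T (b ∸ a ∸ bit (pyr a b))
      legs {x} {y} _ _ S≗ with removed-by (λ _ → refl) S≗ T-ρa+p (ρ+p-gap a<p) | removed-by (λ _ → refl) S≗ T-ρb+p (ρ+p-gap b<p)
      ... | inj₁ e₁    | inj₁ e₂    = ⊥-elim (<⇒≢ ρa+p<ρb+p (trans e₁ (sym e₂)))
      ... | inj₂ e₁    | inj₂ e₂    = ⊥-elim (<⇒≢ ρa+p<ρb+p (trans e₁ (sym e₂)))
      ... | inj₁ refl | inj₂ refl =
        ∣l-r∣≡d∸c c≤b∸a (trans leg-ρa+p (trans (p∸[1+a]≡p∸[1+b]+[b∸a] (ℕP.<⇒≤ a<b) b<p)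
                                              (cong (ℕ._+ (b ∸ a)) (sym (legCount-ρ+p b<p)))))
        where c≤b∸a = ℕP.≤-trans (bit≤1 (pyr a b)) (ℕP.m<n⇒0<n∸m a<b)
      ... | inj₂ refl | inj₁ refl =
        trans (cong₂ ∣_-_∣ leg-ρb+p (trans (legCount-ρ+p a<p) (p∸[1+a]≡p∸[1+b]+[b∸a] (ℕP.<⇒≤ a<b) b<p)))
              (∣r+c-[r+d]∣≡d∸c (p ∸ suc b) (ℕP.≤-trans (bit≤1 (pyr a b)) (ℕP.m<n⇒0<n∸m a<b)))

    module Square {a b} (a<b : a ℕ.< b) (b<p : b ℕ.< p) (ρa+p<ρb : ρ a + + p < ρ b)
                  (ρb<ρ[1+a]+p : ρ b < ρ (suc a) + + p) where

      a<p = ℕP.<-trans a<b b<p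
      ρb<ρb+p = i<i+1+n (ρ b) (suc q)
      ρb-p<ρb = i-1+n<i (ρ b) (suc q)

      S₁ T : ℤ → Bool
      S₁ = mv S (ρ b) (ρ b + + p)
      T = mv S₁ (ρ b - + p) (ρ b)

      T-other : ∀ {z} → z ≢ ρ b - + p → z ≢ ρ b → z ≢ ρ b + + p → T z ≡ S z
      T-other z≢ρb-p z≢ρb z≢ρb+p = trans (mv-other S₁ z≢ρb z≢ρb-p) (mv-other S z≢ρb+p z≢ρb)

      T-ρb+p : T (ρ b + + p) ≡ true
      T-ρb+p = trans (mv-other S₁ (>⇒≢ ρb<ρb+p) (>⇒≢ (ℤP.<-trans ρb-p<ρb ρb<ρb+p))) (mv-to S (ρ b) (ρ b + + p))

      T-ρb : T (ρ b) ≡ true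
      T-ρb = mv-to S₁ (ρ b - + p) (ρ b)

      T-ρb-p : T (ρ b - + p) ≡ false
      T-ρb-p = mv-from S₁ (<⇒≢ ρb-p<ρb)

      leg-ρb : legCount T p (ρ b) ℕ.+ 1 ≡ p ∸ suc a
      leg-ρb = trans (cong (ℕ._+ 1) (legCount-cong T S (suc q) (ρ b) agree))
                     (legCount-bead a (ρ b) (ρ-bead b<p) a<p (ℤP.<⇒≤ lo) (λ _ → hi))
        where
        agree : ∀ z → ρ b - + p < z → z < ρ b → T z ≡ S z
        agree z lo hi = T-other (>⇒≢ lo) (<⇒≢ hi) (<⇒≢ (ℤP.<-trans hi ρb<ρb+p))
        lo : ρ a < ρ b - + p
        lo = +-cancelʳ-< (+ p) (subst (ρ a + + p <_) (sym (i-j+j≡i (ρ b) (+ p))) ρa+p<ρb)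
        hi : ρ b - + p < ρ (suc a)
        hi = +-cancelʳ-< (+ p) (subst (_< ρ (suc a) + + p) (sym (i-j+j≡i (ρ b) (+ p))) ρb<ρ[1+a]+p)

      legs : HookLegs T (b ∸ a ∸ 1)
      legs {x} {y} _ Tx-p S≗
        with removed-by {z = ρ b + + p} (λ _ → refl) S≗ T-ρb+p (ρ+p-gap b<p)
           | added-by {z = ρ b - + p} (λ _ → refl) S≗ (>⇒≢ (i-1+n<i x (suc q))) (>⇒≢ (i-1+n<i y (suc q)))
                      T-ρb-p (bead-below (ρ b) (ρ-bead b<p))
      ... | inj₁ refl | _ = ⊥-elim (true≢false (trans (sym T-ρb) (trans (cong T (sym (i+j-j≡i (ρ b) (+ p)))) Tx-p)))
      ... | inj₂ refl | inj₂ e = ⊥-elim (<⇒≢ ρb-p<ρb (trans e (i+j-j≡i (ρ b) (+ p))))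
      ... | inj₂ refl | inj₁ e with +-cancelʳ-≡ {ρ b} {x} (- + p) e
      ...   | refl = ∣l-r∣≡d∸c (ℕP.m<n⇒0<n∸m a<b)
                       (trans leg-ρb (trans (p∸[1+a]≡p∸[1+b]+[b∸a] (ℕP.<⇒≤ a<b) b<p)
                                            (cong (ℕ._+ (b ∸ a)) (sym (legCount-ρ+p b<p)))))

    module Single {a b} (a<b : a ℕ.< b) (b<p : b ℕ.< p) (ρb<ρa+p : ρ b < ρ a + + p)
                  (ρa+p<ρ[1+b] : suc b ℕ.< p → ρ a + + p < ρ (suc b)) where

      a<p = ℕP.<-trans a<b b<p
      ρa<ρa+p = i<i+1+n (ρ a) (suc q)
      ρa+p<ρa+2p = i<i+1+n (ρ a + + p) (suc q)
      ρa<ρa+2p = ℤP.<-trans ρa<ρa+p ρa+p<ρa+2p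
      ρa+2p-p≡ρa+p = i+j-j≡i (ρ a + + p) (+ p)

      T : ℤ → Bool
      T = mv S (ρ a) (ρ a + + p + + p)

      T-ρa+2p : T (ρ a + + p + + p) ≡ true
      T-ρa+2p = mv-to S (ρ a) (ρ a + + p + + p)

      T-ρa : T (ρ a) ≡ false
      T-ρa = mv-from S (<⇒≢ ρa<ρa+2p)

      T-ρa+p : T (ρ a + + p) ≡ false
      T-ρa+p = trans (mv-other S (<⇒≢ ρa+p<ρa+2p) (>⇒≢ ρa<ρa+p)) (ρ+p-gap a<p)

      leg-ρa+2p : legCount T p (ρ a + + p + + p) ≡ p ∸ suc b
      leg-ρa+2p = trans (legCount-cong T S (suc q) (ρ a + + p + + p) agree)
                        (legCount-gap b (ρ a + + p + + p) (ρ+2p-gap a<p) b<p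
                                      (ℤP.≤-trans (ℤP.<⇒≤ ρb<ρa+p) (ℤP.≤-reflexive (sym ρa+2p-p≡ρa+p)))
                                      (subst (_< _) (sym ρa+2p-p≡ρa+p) ∘ ρa+p<ρ[1+b]))
        where
        agree : ∀ z → ρ a + + p + + p - + p < z → z < ρ a + + p + + p → T z ≡ S z
        agree z lo hi = mv-other S (<⇒≢ hi) (>⇒≢ (ℤP.<-trans ρa<ρa+p (subst (_< z) ρa+2p-p≡ρa+p lo)))

      legs : HookLegs T (b ∸ a)
      legs {x} {y} Tx _ S≗
        with removed-by {z = ρ a + + p + + p} (λ _ → refl) S≗ T-ρa+2p (ρ+2p-gap a<p)
           | added-by {z = ρ a} (λ _ → refl) S≗ (>⇒≢ (i-1+n<i x (suc q))) (>⇒≢ (i-1+n<i y (suc q))) T-ρa (ρ-bead a<p)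
      ... | inj₁ refl | inj₁ e = ⊥-elim (<⇒≢ ρa<ρa+p (trans e ρa+2p-p≡ρa+p))
      ... | inj₂ refl | inj₂ e = ⊥-elim (<⇒≢ ρa<ρa+p (trans e ρa+2p-p≡ρa+p))
      ... | inj₂ refl | inj₁ e = ⊥-elim (true≢false (trans (sym Tx) (trans (cong T x≡ρa+p) T-ρa+p)))
        where
        x≡ρa+p : x ≡ ρ a + + p
        x≡ρa+p = trans (sym (i-j+j≡i x (+ p))) (cong (_+ + p) (sym e))
      ... | inj₁ refl | inj₂ e with +-cancelʳ-≡ {y} {ρ a + + p} (- + p) (trans (sym e) (sym (i+j-j≡i (ρ a) (+ p))))
      ...   | refl = trans (cong₂ ∣_-_∣ leg-ρa+2p (trans (legCount-ρ+p a<p) (p∸[1+a]≡p∸[1+b]+[b∸a] (ℕP.<⇒≤ a<b) b<p)))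
                           (ℕP.∣m-m+n∣≡n (p ∸ suc b) (b ∸ a))

    pair-∈∂ : ∀ {a b} → a ℕ.< b → b ℕ.< p → pair a b ∈∂ (b ∸ a ∸ bit (pyr a b))
    pair-∈∂ {a} {b} a<b b<p = ∈∂-intro (pair a b) _ (ρ-bead a<p) (ρ+p-gap a<p) S₁-ρb S₁-ρb+p (λ _ → refl) legs
      where
      open Pair a<b b<p
      S₁-ρb : S₁ (ρ b) ≡ true
      S₁-ρb = trans (mv-other S ρb≢ρa+p (>⇒≢ ρa<ρb)) (ρ-bead b<p)
        where
        ρb≢ρa+p : ρ b ≢ ρ a + + p
        ρb≢ρa+p e = true≢false (trans (sym (ρ-bead b<p)) (trans (cong S e) (ρ+p-gap a<p)))
      S₁-ρb+p : S₁ (ρ b + + p) ≡ false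
      S₁-ρb+p = trans (mv-other S (>⇒≢ ρa+p<ρb+p) (>⇒≢ (ℤP.<-trans ρa<ρb (i<i+1+n (ρ b) (suc q))))) (ρ+p-gap b<p)

    square-∈∂ : ∀ {a b} → a ℕ.< b → b ℕ.< p → pyr (suc a) b ≡ true → pyr a b ≡ false →
                sq b ∈∂ (b ∸ a ∸ 1)
    square-∈∂ {a} {b} a<b b<p close far =
      ∈∂-intro (sq b) _ (ρ-bead b<p) (ρ+p-gap b<p) S₁-ρb-p S₁-ρb L≗ legs
      where
      open Square a<b b<p (pyr-false⇒ (ℕP.<⇒≤ a<b) b<p far) (pyr-true⇒ a<b b<p close)
      ρb-p+p≡ρb = i-j+j≡i (ρ b) (+ p)
      S₁-ρb-p : S₁ (ρ b - + p) ≡ true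
      S₁-ρb-p = trans (mv-other S (<⇒≢ (ℤP.<-trans ρb-p<ρb ρb<ρb+p)) (<⇒≢ ρb-p<ρb)) (bead-below (ρ b) (ρ-bead b<p))
      S₁-ρb : S₁ (ρ b - + p + + p) ≡ false
      S₁-ρb = trans (cong S₁ ρb-p+p≡ρb) (mv-from S (<⇒≢ ρb<ρb+p))
      L≗ : T ≗ mv S₁ (ρ b - + p) (ρ b - + p + + p)
      L≗ y = cong (λ t → mv S₁ (ρ b - + p) t y) (sym ρb-p+p≡ρb)

    single-∈∂ : ∀ {a b} → a ℕ.< b → b ℕ.< p → pyr a b ≡ true → pyr a (suc b) ≡ false →
                sing a ∈∂ (b ∸ a)
    single-∈∂ {a} {b} a<b b<p close far =
      ∈∂-intro (sing a) _ (ρ-bead a<p) (ρ+p-gap a<p) (mv-to S (ρ a) (ρ a + + p)) S₁-ρa+2p L≗ legs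
      where
      open Single a<b b<p (pyr-true⇒ (ℕP.<⇒≤ a<b) b<p close)
                          (λ 1+b<p → pyr-false⇒ (ℕP.≤-trans (ℕP.<⇒≤ a<b) (ℕP.n≤1+n b)) 1+b<p far)
      S₁-ρa+2p : mv S (ρ a) (ρ a + + p) (ρ a + + p + + p) ≡ false
      S₁-ρa+2p = trans (mv-other S (>⇒≢ ρa+p<ρa+2p) (>⇒≢ ρa<ρa+2p)) (ρ+2p-gap a<p)
      L≗ : T ≗ mv (mv S (ρ a) (ρ a + + p)) (ρ a + + p) (ρ a + + p + + p)
      L≗ y = sym (mv-via-empty S (ρ+p-gap a<p) (<⇒≢ ρa<ρa+p) (<⇒≢ ρa+p<ρa+2p) (<⇒≢ ρa<ρa+2p) y)

    δaux-≤ : ∀ m → δaux m ℕ.≤ m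
    δaux-≤ zero    = z≤n
    δaux-≤ (suc m) with g (suc m)
    ... | true  = ℕP.≤-refl
    ... | false = ℕP.m≤n⇒m≤1+n (δaux-≤ m)

    δaux-g : ∀ m → δaux m ≡ 0 ⊎ g (δaux m) ≡ true
    δaux-g zero    = inj₁ refl
    δaux-g (suc m) with g (suc m) in g[1+m]
    ... | true  = inj₂ g[1+m]
    ... | false = δaux-g m

    δaux-≥ : ∀ m {k} → 1 ℕ.≤ k → k ℕ.≤ m → g k ≡ true → k ℕ.≤ δaux m
    δaux-≥ zero    1≤k k≤0 _ = ⊥-elim (ℕP.<⇒≱ 1≤k k≤0)
    δaux-≥ (suc m) {k} 1≤k k≤1+m gk with g (suc m) in g[1+m]
    ... | true  = k≤1+m
    ... | false with ℕP.m≤n⇒m<n∨m≡n k≤1+m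
    ...   | inj₁ k≤m = δaux-≥ m 1≤k (ℕP.≤-pred k≤m) gk
    ...   | inj₂ refl = ⊥-elim (true≢false (trans (sym gk) g[1+m]))

    module Centred (p-odd : p ℕ.% 2 ≡ 1) where

      h+h≡1+q : h ℕ.+ h ≡ suc q
      h+h≡1+q = odd⇒[n∸1]/2+[n∸1]/2≡n∸1 p p-odd

      h+k<p : ∀ {k} → k ℕ.≤ h → h ℕ.+ k ℕ.< p
      h+k<p {k} k≤h = s≤s (subst (h ℕ.+ k ℕ.≤_) h+h≡1+q (ℕP.+-monoʳ-≤ h k≤h))

      g-antitone : ∀ {j k} → j ℕ.≤ k → k ℕ.≤ h → g k ≡ true → g j ≡ true
      g-antitone {j} {k} j≤k k≤h =
        pyr-inner (ℕP.∸-monoʳ-≤ h j≤k) (ℕP.≤-trans (ℕP.m∸n≤m h j) (ℕP.m≤m+n h j)) (ℕP.+-monoʳ-≤ h j≤k) (h+k<p k≤h)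

      ≤δ⇒g : ∀ {k} → 1 ℕ.≤ k → k ℕ.≤ δ → g k ≡ true
      ≤δ⇒g {k} 1≤k k≤δ with δaux-g h
      ... | inj₁ δ≡0 = ⊥-elim (ℕP.<⇒≱ 1≤k (subst (k ℕ.≤_) δ≡0 k≤δ))
      ... | inj₂ gδ  = g-antitone k≤δ (δaux-≤ h) gδ

      >δ⇒¬g : ∀ {k} → 1 ℕ.≤ k → k ℕ.≤ h → δ ℕ.< k → g k ≡ false
      >δ⇒¬g 1≤k k≤h δ<k = ¬-not λ gk → ℕP.<⇒≱ δ<k (δaux-≥ h 1≤k k≤h gk)

      ceil-right : ∀ {a b} → a ℕ.< b → b ℕ.< p → pyr a b ≡ true → pyr a (suc b) ≡ true → ceil a b ≡ pair a (suc b)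
      ceil-right {a} {b} a<b b<p close wide
        rewrite dec-false (a ℕ.≟ b) (ℕP.<⇒≢ a<b) | pyr-inner (ℕP.n≤1+n a) a<b ℕP.≤-refl b<p close | close | wide = refl

      ceil-single : ∀ {a b} → a ℕ.< b → b ℕ.< p → pyr a b ≡ true → pyr a (suc b) ≡ false → ceil a b ≡ sing a
      ceil-single {a} {b} a<b b<p close narrow
        rewrite dec-false (a ℕ.≟ b) (ℕP.<⇒≢ a<b) | pyr-inner (ℕP.n≤1+n a) a<b ℕP.≤-refl b<p close | close | narrow = refl

      ceil-square : ∀ {a b} → a ℕ.< b → pyr (suc a) b ≡ true → pyr a b ≡ false → ceil a b ≡ sq b
      ceil-square {a} {b} a<b close far rewrite dec-false (a ℕ.≟ b) (ℕP.<⇒≢ a<b) | close | far = refl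

      ceil-left : ∀ {a b} → a ℕ.< b → pyr (suc a) b ≡ false → ceil a b ≡ pair (suc a) b
      ceil-left {a} {b} a<b far rewrite dec-false (a ℕ.≟ b) (ℕP.<⇒≢ a<b) | far = refl

      h∸k<h+k : ∀ {k} → 1 ℕ.≤ k → h ∸ k ℕ.< h ℕ.+ k
      h∸k<h+k {k} 1≤k = ℕP.≤-<-trans (ℕP.m∸n≤m h k) (ℕP.m<m+n h 1≤k)

      [h+k]∸[h∸k]≡2k : ∀ {k} → k ℕ.≤ h → (h ℕ.+ k) ∸ (h ∸ k) ≡ 2 ℕ.* k
      [h+k]∸[h∸k]≡2k {k} k≤h = begin
        (h ℕ.+ k) ∸ (h ∸ k)                 ≡⟨ cong (λ m → (m ℕ.+ k) ∸ (h ∸ k)) (ℕP.m∸n+n≡m k≤h) ⟨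
        ((h ∸ k) ℕ.+ k ℕ.+ k) ∸ (h ∸ k)      ≡⟨ cong (_∸ (h ∸ k)) (ℕP.+-assoc (h ∸ k) k k) ⟩
        ((h ∸ k) ℕ.+ (k ℕ.+ k)) ∸ (h ∸ k)    ≡⟨ ℕP.m+n∸m≡n (h ∸ k) (k ℕ.+ k) ⟩
        k ℕ.+ k                             ≡⟨ cong (k ℕ.+_) (ℕP.+-identityʳ k) ⟨
        2 ℕ.* k                             ∎
        where open ≡-Reasoning

      ν-∈∂ : ∀ {k} → 1 ℕ.≤ k → k ℕ.≤ h → pair (h ∸ k) (h ℕ.+ k) ∈∂ (2 ℕ.* k ∸ bit (g k))
      ν-∈∂ {k} 1≤k k≤h = subst (λ d → pair (h ∸ k) (h ℕ.+ k) ∈∂ (d ∸ bit (g k))) ([h+k]∸[h∸k]≡2k k≤h)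
                               (pair-∈∂ (h∸k<h+k 1≤k) (h+k<p k≤h))

      μ-∈∂-close : ∀ {k} → 1 ℕ.≤ k → k ℕ.≤ h → g k ≡ true → ceil (h ∸ k) (h ℕ.+ k) ∈∂ 2 ℕ.* k
      μ-∈∂-close {k} 1≤k k≤h close = by-width (pyr a (suc b)) refl
        where
        a = h ∸ k
        b = h ℕ.+ k
        a<b = h∸k<h+k 1≤k
        b<p = h+k<p k≤h
        by-width : ∀ w → pyr a (suc b) ≡ w → ceil a b ∈∂ 2 ℕ.* k
        by-width false narrow = subst₂ _∈∂_ (sym (ceil-single a<b b<p close narrow)) ([h+k]∸[h∸k]≡2k k≤h)
                                       (single-∈∂ a<b b<p close narrow)
        by-width true  wide   = subst₂ _∈∂_ (sym (ceil-right a<b b<p close wide)) [1+b∸a]∸1≡2k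
                                       (pair-∈∂ (ℕP.m<n⇒m<1+n a<b) 1+b<p)
          where
          1+b<p : suc b ℕ.< p
          1+b<p = ℕP.≰⇒> λ p≤1+b → true≢false (trans (sym wide) (pyr-beyond (ℕP.m≤n⇒m≤1+n (ℕP.<⇒≤ a<b)) p≤1+b))
          [1+b∸a]∸1≡2k : suc b ∸ a ∸ bit (pyr a (suc b)) ≡ 2 ℕ.* k
          [1+b∸a]∸1≡2k = trans (cong (λ c → suc b ∸ a ∸ bit c) wide)
                               (trans (cong (_∸ 1) (ℕP.+-∸-assoc 1 (ℕP.<⇒≤ a<b))) ([h+k]∸[h∸k]≡2k k≤h))

      μ-∈∂-far : ∀ {k} → 1 ℕ.≤ k → k ℕ.≤ h → g k ≡ false → ceil (h ∸ k) (h ℕ.+ k) ∈∂ 2 ℕ.* k ∸ 1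
      μ-∈∂-far {k} 1≤k k≤h far = by-inner (pyr (suc a) b) refl
        where
        a = h ∸ k
        b = h ℕ.+ k
        a<b = h∸k<h+k 1≤k
        b<p = h+k<p k≤h
        b∸a∸1≡2k∸1 = cong (_∸ 1) ([h+k]∸[h∸k]≡2k k≤h)
        by-inner : ∀ w → pyr (suc a) b ≡ w → ceil a b ∈∂ 2 ℕ.* k ∸ 1
        by-inner true  close  = subst₂ _∈∂_ (sym (ceil-square a<b close far)) b∸a∸1≡2k∸1 (square-∈∂ a<b b<p close far)
        by-inner false narrow = subst₂ _∈∂_ (sym (ceil-left a<b narrow)) b∸[1+a]≡2k∸1 (pair-∈∂ 1+a<b b<p)
          where
          b∸[1+a]≡2k∸1 : b ∸ suc a ∸ bit (pyr (suc a) b) ≡ 2 ℕ.* k ∸ 1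
          b∸[1+a]≡2k∸1 = trans (cong (λ c → b ∸ suc a ∸ bit c) narrow)
                               (trans (trans (cong (b ∸_) (ℕP.+-comm 1 a)) (sym (ℕP.∸-+-assoc b a 1))) b∸a∸1≡2k∸1)
          1+a<b : suc a ℕ.< b
          1+a<b = subst₂ ℕ._≤_ (ℕP.+-comm a 2) (ℕP.m+[n∸m]≡n (ℕP.<⇒≤ a<b))
                         (ℕP.+-monoʳ-≤ a (subst (2 ℕ.≤_) (sym ([h+k]∸[h∸k]≡2k k≤h)) (ℕP.*-monoʳ-≤ 2 1≤k)))

open Abacus using (module Core)
open import Data.Nat using (_+_; _*_; _≤_; _<_; _%_)

lemma3p21 : (p : ℕ) → Prime p → p % 2 ≡ 1 →
  (n : ℕ) (γ : List ℕ) → IsPartition γ → size γ + 2 * p ≡ n →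
  IsCore p γ → conj γ ≡ γ →
  (ρ : ℕ → ℤ) → IsRho p γ ρ →
  (k : ℕ) → 1 ≤ k → k ≤ Labels.h p ρ →
    (k ≤ Labels.δ p ρ →
       LabelIn p ρ γ n (Labels.ceil p ρ (Labels.h p ρ ∸ k) (Labels.h p ρ + k)) (2 * k)
       × LabelIn p ρ γ n (pair (Labels.h p ρ ∸ k) (Labels.h p ρ + k)) (2 * k ∸ 1))
    × (Labels.δ p ρ < k →
       LabelIn p ρ γ n (Labels.ceil p ρ (Labels.h p ρ ∸ k) (Labels.h p ρ + k)) (2 * k ∸ 1)
       × LabelIn p ρ γ n (pair (Labels.h p ρ ∸ k) (Labels.h p ρ + k)) (2 * k))
lemma3p21 zero          _ _ _ _ _ _ _ _ _ _ _ 1≤k k≤h = ⊥-elim (ℕP.<⇒≱ 1≤k k≤h)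
lemma3p21 (suc zero)    _ _ _ _ _ _ _ _ _ _ _ 1≤k k≤h = ⊥-elim (ℕP.<⇒≱ 1≤k k≤h)
lemma3p21 (suc (suc q)) _ p-odd _ γ γ-partition refl γ-core _ ρ ρ-spec k 1≤k k≤h =
  (λ k≤δ → μ-∈∂-close 1≤k k≤h (≤δ⇒g 1≤k k≤δ) , subst ν-in (≤δ⇒g 1≤k k≤δ) (ν-∈∂ 1≤k k≤h)) ,
  (λ δ<k → μ-∈∂-far 1≤k k≤h (>δ⇒¬g 1≤k k≤h δ<k) , subst ν-in (>δ⇒¬g 1≤k k≤h δ<k) (ν-∈∂ 1≤k k≤h))
  where
  open Core γ-partition γ-core ρ-spec
  open Centred p-odd
  open Labels (suc (suc q)) ρ using (h)
  ν-in : Bool → Set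
  ν-in c = pair (h ∸ k) (h + k) ∈∂ 2 * k ∸ bit c
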